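{- Let $k$ be a positive integer that is a perfect square. Then there is an integer $N=N(k)$ such that for each integer $n\ge N$ there exists a symmetric weighing matrix $W(n,k)$.
   Context: A weighing matrix $W(n,k)$ of order $n$ and weight $k$ is a square matrix $W$ of order $n$ with entries in $\{0,\pm1\}$ such that $WW^{\rm T}=kI_n$. It is symmetric if $W^{\rm T}=W$. -}

module Defs where

open import Data.Nat using (ℕ; zero; suc)
open import Data.Fin using (Fin; zero; suc)
open import Data.Integer using (ℤ; +_; -[1+_]; _+_; _*_; 0ℤ; 1ℤ; -1ℤ)
open import Data.Product using (_×_)
open import Data.Sum using (_⊎_)
open import Relation.Binary.PropositionalEquality using (_≡_)
import Data.Fin
import Relation.Nullary

Matrix : ℕ → Set
Matrix n = Fin n → Fin n → ℤ

∑ : (n : ℕ) → (Fin n → ℤ) → ℤ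
∑ zero    f = 0ℤ
∑ (suc n) f = f zero + ∑ n (λ i → f (suc i))

IsTernary : ℤ → Set
IsTernary x = (x ≡ 0ℤ) ⊎ ((x ≡ 1ℤ) ⊎ (x ≡ -1ℤ))

scaledId : (n : ℕ) → ℕ → Matrix n
scaledId n k i j with i Data.Fin.≟ j
... | Relation.Nullary.yes _ = + k
... | Relation.Nullary.no  _ = 0ℤ

mulTranspose : (n : ℕ) → Matrix n → Matrix n
mulTranspose n W i j = ∑ n (λ l → W i l * W j l)

IsWeighingMatrix : (n k : ℕ) → Matrix n → Set
IsWeighingMatrix n k W =
  (∀ i j → IsTernary (W i j)) × (∀ i j → mulTranspose n W i j ≡ scaledId n k i j)

IsSymmetric : (n : ℕ) → Matrix n → Set
IsSymmetric n W = ∀ i j → W i j ≡ W j i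

module Submission where

-- Direct sums of symmetric weighing matrices of equal weight are again such matrices, and
-- Kronecker products multiply the weights. Doubling A ↦ [[A, I], [I, −A]] raises the weight by
-- one, so there is a symmetric W(2^(k−1), k). For an odd prime p, let χ be the Legendre symbol and
-- xᵢ representatives of the p² + p + 1 points of the projective plane over 𝔽ₚ; then (χ(xᵢ · xⱼ))
-- is a symmetric W(p² + p + 1, p²): up to the factor p − 1 its Gram entries are character sums
-- over 𝔽ₚ³, which vanish off the diagonal because χ sums to zero over 𝔽ₚ. Together with W(7,4)
-- for p = 2, Kronecker products over the prime factors of m give a symmetric W(O, m²) with O odd.
-- Since O is a unit modulo 2^k, some multiple of O is a + 1 with 2^(k−1) ∣ a, so a and a + 1 are
-- both orders of symmetric weighing matrices of weight k = m², and every n ≥ a² is a sum of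
-- copies of a and a + 1.

open import Defs
open import Data.Nat as ℕ using (ℕ; zero; suc; NonZero; _≤_; _≥_; _^_)
import Data.Nat.Properties as ℕP
open import Data.Nat.Primality using (Prime; ¬prime[0]; ¬prime[1])
open import Data.Fin as F using (Fin; zero; suc; toℕ; _↑ˡ_; _↑ʳ_; splitAt; combine; remQuot)
import Data.Fin.Properties as FP
open import Data.Product using (Σ; _×_; _,_; proj₁; proj₂; ∃-syntax)
open import Data.Sum using (_⊎_; inj₁; inj₂; [_,_]′; reduce)
open import Data.Empty using (⊥-elim)
open import Function using (_∘_)
open import Relation.Binary.PropositionalEquality
open import Relation.Nullary using (¬_; Dec; yes; no)

module Matrices where

  open import Data.Integer as ℤ using (ℤ; +_; _+_; _-_; _*_; -_; 0ℤ; 1ℤ; -1ℤ)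
  import Data.Integer.Properties as ℤP
  open import Data.Integer.Tactic.RingSolver using (solve-∀)
  open import Relation.Nullary.Decidable using (True; toWitness; _⊎-dec_)
  open import Data.Vec using (Vec; _∷_; []; lookup)
  import Algebra.Properties.Semiring.Sum ℤP.+-*-semiring as Sum

  ∑≡sum : ∀ n (f : Fin n → ℤ) → ∑ n f ≡ Sum.sum f
  ∑≡sum zero    f = refl
  ∑≡sum (suc n) f = cong (_+_ (f zero)) (∑≡sum n (f ∘ suc))

  ∑-cong : ∀ n {f g : Fin n → ℤ} → (∀ i → f i ≡ g i) → ∑ n f ≡ ∑ n g
  ∑-cong zero    f≗g = refl
  ∑-cong (suc n) f≗g = cong₂ _+_ (f≗g zero) (∑-cong n (f≗g ∘ suc))

  ∑-zero : ∀ n → ∑ n (λ _ → 0ℤ) ≡ 0ℤ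
  ∑-zero n = trans (∑≡sum n _) (Sum.sum-replicate-zero n)

  ∑-const : ∀ n c → ∑ n (λ _ → c) ≡ + n * c
  ∑-const zero    c = sym (ℤP.*-zeroˡ c)
  ∑-const (suc n) c = begin
    c + ∑ n (λ _ → c)  ≡⟨ cong (_+_ c) (∑-const n c) ⟩
    c + + n * c        ≡⟨ cong (λ x → x + + n * c) (ℤP.*-identityˡ c) ⟨
    1ℤ * c + + n * c   ≡⟨ ℤP.*-distribʳ-+ c 1ℤ (+ n) ⟨
    + suc n * c        ∎
    where open ≡-Reasoning

  ∑-+ : ∀ n (f g : Fin n → ℤ) → ∑ n (λ i → f i + g i) ≡ ∑ n f + ∑ n g
  ∑-+ n f g = begin
    ∑ n (λ i → f i + g i)          ≡⟨ ∑≡sum n _ ⟩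
    Sum.sum (λ i → f i + g i)      ≡⟨ Sum.∑-distrib-+ f g ⟩
    Sum.sum f + Sum.sum g          ≡⟨ cong₂ _+_ (∑≡sum n f) (∑≡sum n g) ⟨
    ∑ n f + ∑ n g                  ∎
    where open ≡-Reasoning

  ∑-*ˡ : ∀ n c (f : Fin n → ℤ) → ∑ n (λ i → c * f i) ≡ c * ∑ n f
  ∑-*ˡ n c f = begin
    ∑ n (λ i → c * f i)      ≡⟨ ∑≡sum n _ ⟩
    Sum.sum (λ i → c * f i)  ≡⟨ Sum.*-distribˡ-sum c f ⟨
    c * Sum.sum f            ≡⟨ cong (c *_) (∑≡sum n f) ⟨
    c * ∑ n f                ∎
    where open ≡-Reasoning

  ∑-*ʳ : ∀ n c (f : Fin n → ℤ) → ∑ n (λ i → f i * c) ≡ ∑ n f * c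
  ∑-*ʳ n c f = begin
    ∑ n (λ i → f i * c)  ≡⟨ ∑-cong n (λ i → ℤP.*-comm (f i) c) ⟩
    ∑ n (λ i → c * f i)  ≡⟨ ∑-*ˡ n c f ⟩
    c * ∑ n f            ≡⟨ ℤP.*-comm c _ ⟩
    ∑ n f * c            ∎
    where open ≡-Reasoning

  ∑-comm : ∀ m n (f : Fin m → Fin n → ℤ) →
    ∑ m (λ i → ∑ n (f i)) ≡ ∑ n (λ j → ∑ m (λ i → f i j))
  ∑-comm m n f = begin
    ∑ m (λ i → ∑ n (f i))                  ≡⟨ ∑-cong m (λ i → ∑≡sum n (f i)) ⟩
    ∑ m (λ i → Sum.sum (f i))              ≡⟨ ∑≡sum m _ ⟩
    Sum.sum (λ i → Sum.sum (f i))          ≡⟨ Sum.∑-comm f ⟩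
    Sum.sum (λ j → Sum.sum (λ i → f i j))  ≡⟨ ∑≡sum n _ ⟨
    ∑ n (λ j → Sum.sum (λ i → f i j))      ≡⟨ ∑-cong n (λ j → ∑≡sum m (λ i → f i j)) ⟨
    ∑ n (λ j → ∑ m (λ i → f i j))          ∎
    where open ≡-Reasoning

  ∑-splitAt : ∀ a b (f : Fin (a ℕ.+ b) → ℤ) →
    ∑ (a ℕ.+ b) f ≡ ∑ a (λ i → f (i ↑ˡ b)) + ∑ b (λ i → f (a ↑ʳ i))
  ∑-splitAt zero    b f = sym (ℤP.+-identityˡ _)
  ∑-splitAt (suc a) b f = begin
    f zero + ∑ (a ℕ.+ b) (f ∘ suc)                                ≡⟨ cong (_+_ (f zero)) (∑-splitAt a b (f ∘ suc)) ⟩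
    f zero + (∑ a (λ i → f (suc (i ↑ˡ b))) + ∑ b (λ i → f (suc a ↑ʳ i)))  ≡⟨ ℤP.+-assoc (f zero) _ _ ⟨
    f zero + ∑ a (λ i → f (suc (i ↑ˡ b))) + ∑ b (λ i → f (suc a ↑ʳ i))    ∎
    where open ≡-Reasoning

  ∑-combine : ∀ a b (f : Fin (a ℕ.* b) → ℤ) →
    ∑ (a ℕ.* b) f ≡ ∑ a (λ i → ∑ b (λ j → f (combine i j)))
  ∑-combine zero    b f = refl
  ∑-combine (suc a) b f = begin
    ∑ (b ℕ.+ a ℕ.* b) f
      ≡⟨ ∑-splitAt b (a ℕ.* b) f ⟩
    ∑ b (λ j → f (j ↑ˡ (a ℕ.* b))) + ∑ (a ℕ.* b) (λ k → f (b ↑ʳ k))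
      ≡⟨ cong (_+_ (∑ b (λ j → f (j ↑ˡ (a ℕ.* b))))) (∑-combine a b (λ k → f (b ↑ʳ k))) ⟩
    ∑ b (λ j → f (j ↑ˡ (a ℕ.* b))) + ∑ a (λ i → ∑ b (λ j → f (b ↑ʳ combine i j))) ∎
    where open ≡-Reasoning

  ∑-*-∑ : ∀ a b (f : Fin a → ℤ) (g : Fin b → ℤ) →
    ∑ a f * ∑ b g ≡ ∑ a (λ i → ∑ b (λ j → f i * g j))
  ∑-*-∑ a b f g = begin
    ∑ a f * ∑ b g                       ≡⟨ ∑-*ʳ a (∑ b g) f ⟨
    ∑ a (λ i → f i * ∑ b g)             ≡⟨ ∑-cong a (λ i → ∑-*ˡ b (f i) g) ⟨
    ∑ a (λ i → ∑ b (λ j → f i * g j))   ∎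
    where open ≡-Reasoning

  ∑-nonneg : ∀ n (f : Fin n → ℤ) → (∀ i → 0ℤ ℤ.≤ f i) → 0ℤ ℤ.≤ ∑ n f
  ∑-nonneg zero    f f≥0 = ℤ.+≤+ ℕ.z≤n
  ∑-nonneg (suc n) f f≥0 = ℤP.+-mono-≤ (f≥0 zero) (∑-nonneg n (f ∘ suc) (f≥0 ∘ suc))

  ∑-nonneg-≡0 : ∀ n (f : Fin n → ℤ) → (∀ i → 0ℤ ℤ.≤ f i) → ∑ n f ≡ 0ℤ → ∀ i → f i ≡ 0ℤ
  ∑-nonneg-≡0 (suc n) f f≥0 ∑≡0 i = go i
    where
    x+y≡0⇒x≡0 : ∀ {x y} → 0ℤ ℤ.≤ x → 0ℤ ℤ.≤ y → x + y ≡ 0ℤ → x ≡ 0ℤ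
    x+y≡0⇒x≡0 {+ m} (ℤ.+≤+ _) (ℤ.+≤+ _) eq = cong +_ (ℕP.m+n≡0⇒m≡0 m (ℤP.+-injective eq))
    head≡0 : f zero ≡ 0ℤ
    head≡0 = x+y≡0⇒x≡0 (f≥0 zero) (∑-nonneg n (f ∘ suc) (f≥0 ∘ suc)) ∑≡0
    go : ∀ i → f i ≡ 0ℤ
    go zero    = head≡0
    go (suc i) = ∑-nonneg-≡0 n (f ∘ suc) (f≥0 ∘ suc)
      (trans (sym (ℤP.+-identityˡ _)) (trans (cong (_+ ∑ n (f ∘ suc)) (sym head≡0)) ∑≡0)) i

  scaledId-≡ : ∀ {n} k {i j : Fin n} → i ≡ j → scaledId n k i j ≡ + k
  scaledId-≡ k {i} refl with i F.≟ i
  ... | yes _   = refl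
  ... | no  i≢i = ⊥-elim (i≢i refl)

  scaledId-≢ : ∀ {n} k {i j : Fin n} → ¬ i ≡ j → scaledId n k i j ≡ 0ℤ
  scaledId-≢ k {i} {j} i≢j with i F.≟ j
  ... | yes i≡j = ⊥-elim (i≢j i≡j)
  ... | no  _   = refl

  scaledId-elim : ∀ {ℓ} (P : ℤ → Set ℓ) {n} k (i j : Fin n) →
    (i ≡ j → P (+ k)) → (¬ i ≡ j → P 0ℤ) → P (scaledId n k i j)
  scaledId-elim P k i j on off with i F.≟ j
  ... | yes i≡j = on i≡j
  ... | no  i≢j = off i≢j

  scaledId-sym : ∀ {n} k (i j : Fin n) → scaledId n k i j ≡ scaledId n k j i
  scaledId-sym k i j = scaledId-elim (λ x → x ≡ scaledId _ k j i) k i j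
    (λ i≡j → sym (scaledId-≡ k (sym i≡j)))
    (λ i≢j → sym (scaledId-≢ k (i≢j ∘ sym)))

  scaledId-ternary : ∀ {n} (i j : Fin n) → IsTernary (scaledId n 1 i j)
  scaledId-ternary i j = scaledId-elim IsTernary 1 i j (λ _ → inj₂ (inj₁ refl)) (λ _ → inj₁ refl)

  scaledId-+ : ∀ {n} k l (i j : Fin n) → scaledId n k i j + scaledId n l i j ≡ scaledId n (k ℕ.+ l) i j
  scaledId-+ k l i j = scaledId-elim (λ x → x + scaledId _ l i j ≡ scaledId _ (k ℕ.+ l) i j) k i j
    (λ i≡j → trans (cong (_+_ (+ k)) (scaledId-≡ l i≡j)) (sym (scaledId-≡ (k ℕ.+ l) i≡j)))
    (λ i≢j → trans (ℤP.+-identityˡ _) (trans (scaledId-≢ l i≢j) (sym (scaledId-≢ (k ℕ.+ l) i≢j))))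

  scaledId-injective : ∀ {m n} k {f : Fin m → Fin n} → (∀ {x y} → f x ≡ f y → x ≡ y) →
    (x y : Fin m) → scaledId n k (f x) (f y) ≡ scaledId m k x y
  scaledId-injective k f-inj x y = scaledId-elim (λ z → scaledId _ k _ _ ≡ z) k x y
    (λ x≡y → scaledId-≡ k (cong _ x≡y))
    (λ x≢y → scaledId-≢ k (x≢y ∘ f-inj))

  ∑-scaledId : ∀ n (i : Fin n) (f : Fin n → ℤ) → ∑ n (λ l → scaledId n 1 i l * f l) ≡ f i
  ∑-scaledId (suc n) zero f = begin
    scaledId (suc n) 1 zero zero * f zero + ∑ n (λ l → scaledId (suc n) 1 zero (suc l) * f (suc l))
      ≡⟨ cong₂ _+_ (cong (_* f zero) (scaledId-≡ 1 {zero {n}} refl))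
                   (∑-cong n (λ l → cong (_* f (suc l)) (scaledId-≢ 1 {zero} {suc l} λ ()))) ⟩
    1ℤ * f zero + ∑ n (λ l → 0ℤ * f (suc l))
      ≡⟨ cong₂ _+_ (ℤP.*-identityˡ (f zero)) (∑-zero n) ⟩
    f zero + 0ℤ
      ≡⟨ ℤP.+-identityʳ (f zero) ⟩
    f zero ∎
    where open ≡-Reasoning
  ∑-scaledId (suc n) (suc i) f = begin
    scaledId (suc n) 1 (suc i) zero * f zero + ∑ n (λ l → scaledId (suc n) 1 (suc i) (suc l) * f (suc l))
      ≡⟨ cong₂ _+_ (cong (_* f zero) (scaledId-≢ 1 {suc i} {zero} λ ()))
                   (∑-cong n (λ l → cong (_* f (suc l)) (scaledId-injective 1 FP.suc-injective i l))) ⟩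
    0ℤ * f zero + ∑ n (λ l → scaledId n 1 i l * f (suc l))
      ≡⟨ cong (_+_ (0ℤ * f zero)) (∑-scaledId n i (f ∘ suc)) ⟩
    0ℤ * f zero + f (suc i)
      ≡⟨ ℤP.+-identityˡ (f (suc i)) ⟩
    f (suc i) ∎
    where open ≡-Reasoning

  scaledId-combine : ∀ {a b} k l (i₁ j₁ : Fin a) (i₂ j₂ : Fin b) →
    scaledId (a ℕ.* b) (k ℕ.* l) (combine i₁ i₂) (combine j₁ j₂) ≡ scaledId a k i₁ j₁ * scaledId b l i₂ j₂
  scaledId-combine {a} {b} k l i₁ j₁ i₂ j₂ =
    scaledId-elim (λ x → scaledId (a ℕ.* b) (k ℕ.* l) (combine i₁ i₂) (combine j₁ j₂) ≡ x * scaledId b l i₂ j₂) k i₁ j₁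
      (λ { refl → scaledId-elim (λ y → scaledId (a ℕ.* b) (k ℕ.* l) (combine i₁ i₂) (combine i₁ j₂) ≡ + k * y) l i₂ j₂
            (λ { refl → trans (scaledId-≡ (k ℕ.* l) refl) (ℤP.pos-* k l) })
            (λ i₂≢j₂ → trans (scaledId-≢ (k ℕ.* l) (i₂≢j₂ ∘ proj₂ ∘ FP.combine-injective i₁ i₂ i₁ j₂))
                             (sym (ℤP.*-zeroʳ (+ k)))) })
      (λ i₁≢j₁ → scaledId-≢ (k ℕ.* l) (i₁≢j₁ ∘ proj₁ ∘ FP.combine-injective i₁ i₂ j₁ j₂))

  ternary-* : ∀ {x y} → IsTernary x → IsTernary y → IsTernary (x * y)
  ternary-* (inj₁ refl)        _                  = inj₁ refl
  ternary-* {x} (inj₂ _)       (inj₁ refl)        = inj₁ (ℤP.*-zeroʳ x)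
  ternary-* (inj₂ (inj₁ refl)) (inj₂ (inj₁ refl)) = inj₂ (inj₁ refl)
  ternary-* (inj₂ (inj₁ refl)) (inj₂ (inj₂ refl)) = inj₂ (inj₂ refl)
  ternary-* (inj₂ (inj₂ refl)) (inj₂ (inj₁ refl)) = inj₂ (inj₂ refl)
  ternary-* (inj₂ (inj₂ refl)) (inj₂ (inj₂ refl)) = inj₂ (inj₁ refl)

  ternary-neg : ∀ {x} → IsTernary x → IsTernary (- x)
  ternary-neg (inj₁ refl)        = inj₁ refl
  ternary-neg (inj₂ (inj₁ refl)) = inj₂ (inj₂ refl)
  ternary-neg (inj₂ (inj₂ refl)) = inj₂ (inj₁ refl)

  penalty : ℤ → ℤ → ℤ
  penalty x y = (x * x - x) * (1ℤ - y)

  penalty-nonneg : ∀ {x y} → IsTernary x → IsTernary y → 0ℤ ℤ.≤ penalty x y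
  penalty-nonneg (inj₁ refl)        _                  = ℤ.+≤+ ℕ.z≤n
  penalty-nonneg (inj₂ (inj₁ refl)) _                  = ℤ.+≤+ ℕ.z≤n
  penalty-nonneg (inj₂ (inj₂ refl)) (inj₁ refl)        = ℤ.+≤+ ℕ.z≤n
  penalty-nonneg (inj₂ (inj₂ refl)) (inj₂ (inj₁ refl)) = ℤ.+≤+ ℕ.z≤n
  penalty-nonneg (inj₂ (inj₂ refl)) (inj₂ (inj₂ refl)) = ℤ.+≤+ ℕ.z≤n

  penalty-linear : ∀ {x y} → (x ≡ 0ℤ × y ≡ 0ℤ) ⊎ (x ≡ 1ℤ × y ≡ -1ℤ) ⊎ x ≡ -1ℤ → penalty x y ≡ - (+ 2) * (x + y)
  penalty-linear         (inj₁ (refl , refl))        = refl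
  penalty-linear         (inj₂ (inj₁ (refl , refl))) = refl
  penalty-linear {y = y} (inj₂ (inj₂ refl))          = identity y
    where
    identity : ∀ y → (-1ℤ * -1ℤ - -1ℤ) * (1ℤ - y) ≡ - (+ 2) * (-1ℤ + y)
    identity = solve-∀

  SymmetricWeighingMatrix : ℕ → ℕ → Set
  SymmetricWeighingMatrix n k = Σ (Matrix n) (λ W → IsWeighingMatrix n k W × IsSymmetric n W)

  Block : ℕ → ℕ → Set
  Block m n = Fin m → Fin n → ℤ

  gram : ∀ {m m′ n} → Block m n → Block m′ n → Block m m′
  gram {n = n} X Y i j = ∑ n (λ l → X i l * Y j l)

  gram-swap : ∀ {m m′ n} (X : Block m n) (Y : Block m′ n) i j → gram X Y i j ≡ gram Y X j i
  gram-swap {n = n} X Y i j = ∑-cong n (λ l → ℤP.*-comm (X i l) (Y j l))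

  gram-zeroʳ : ∀ {m m′ n} (X : Block m n) i (j : Fin m′) → gram X (λ _ _ → 0ℤ) i j ≡ 0ℤ
  gram-zeroʳ {n = n} X i j = trans (∑-cong n (λ l → ℤP.*-zeroʳ (X i l))) (∑-zero n)

  gram-zeroˡ : ∀ {m m′ n} (Y : Block m′ n) (i : Fin m) j → gram (λ _ _ → 0ℤ) Y i j ≡ 0ℤ
  gram-zeroˡ {n = n} Y i j = ∑-zero n

  gram-idˡ : ∀ {m n} (Y : Block m n) i j → gram (scaledId n 1) Y i j ≡ Y j i
  gram-idˡ {n = n} Y i j = ∑-scaledId n i (Y j)

  gram-idʳ : ∀ {m n} (X : Block m n) i j → gram X (scaledId n 1) i j ≡ X i j
  gram-idʳ {n = n} X i j = trans (gram-swap X (scaledId n 1) i j) (gram-idˡ X j i)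

  gram-neg : ∀ {m m′ n} (X : Block m n) (Y : Block m′ n) i j →
    gram (λ a b → - X a b) (λ a b → - Y a b) i j ≡ gram X Y i j
  gram-neg {n = n} X Y i j = ∑-cong n (λ l → neg*neg (X i l) (Y j l))
    where
    neg*neg : ∀ x y → (- x) * (- y) ≡ x * y
    neg*neg = solve-∀

  IsTernaryBlock : ∀ {m n} → Block m n → Set
  IsTernaryBlock X = ∀ i j → IsTernary (X i j)

  +-elim : ∀ {ℓ} a b (P : Fin (a ℕ.+ b) → Set ℓ) →
    (∀ x → P (x ↑ˡ b)) → (∀ y → P (a ↑ʳ y)) → ∀ i → P i
  +-elim a b P left right i with splitAt a i in eq
  ... | inj₁ x = subst P (FP.splitAt⁻¹-↑ˡ eq) (left x)
  ... | inj₂ y = subst P (FP.splitAt⁻¹-↑ʳ eq) (right y)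

  ↑ˡ≢↑ʳ : ∀ {a b} (x : Fin a) (y : Fin b) → ¬ x ↑ˡ b ≡ a ↑ʳ y
  ↑ˡ≢↑ʳ {a} {b} x y eq with trans (sym (FP.splitAt-↑ˡ a x b)) (trans (cong (splitAt a) eq) (FP.splitAt-↑ʳ a b y))
  ... | ()

  block : ∀ {a b} → Block a a → Block a b → Block b a → Block b b → Matrix (a ℕ.+ b)
  block {a} A B C D i j with splitAt a i | splitAt a j
  ... | inj₁ x | inj₁ y = A x y
  ... | inj₁ x | inj₂ y = B x y
  ... | inj₂ x | inj₁ y = C x y
  ... | inj₂ x | inj₂ y = D x y

  module _ {a b} (A : Block a a) (B : Block a b) (C : Block b a) (D : Block b b) where

    private
      M = block A B C D

    block-↑ˡ↑ˡ : ∀ x y → M (x ↑ˡ b) (y ↑ˡ b) ≡ A x y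
    block-↑ˡ↑ˡ x y rewrite FP.splitAt-↑ˡ a x b | FP.splitAt-↑ˡ a y b = refl

    block-↑ˡ↑ʳ : ∀ x y → M (x ↑ˡ b) (a ↑ʳ y) ≡ B x y
    block-↑ˡ↑ʳ x y rewrite FP.splitAt-↑ˡ a x b | FP.splitAt-↑ʳ a b y = refl

    block-↑ʳ↑ˡ : ∀ x y → M (a ↑ʳ x) (y ↑ˡ b) ≡ C x y
    block-↑ʳ↑ˡ x y rewrite FP.splitAt-↑ʳ a b x | FP.splitAt-↑ˡ a y b = refl

    block-↑ʳ↑ʳ : ∀ x y → M (a ↑ʳ x) (a ↑ʳ y) ≡ D x y
    block-↑ʳ↑ʳ x y rewrite FP.splitAt-↑ʳ a b x | FP.splitAt-↑ʳ a b y = refl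

    private
      mulTranspose-splitAt : ∀ i j {u v : Fin a → ℤ} {u′ v′ : Fin b → ℤ} →
        (∀ l → M i (l ↑ˡ b) ≡ u l) → (∀ l → M j (l ↑ˡ b) ≡ v l) →
        (∀ l → M i (a ↑ʳ l) ≡ u′ l) → (∀ l → M j (a ↑ʳ l) ≡ v′ l) →
        mulTranspose (a ℕ.+ b) M i j ≡ ∑ a (λ l → u l * v l) + ∑ b (λ l → u′ l * v′ l)
      mulTranspose-splitAt i j iu jv iu′ jv′ = trans (∑-splitAt a b _)
        (cong₂ _+_ (∑-cong a (λ l → cong₂ _*_ (iu l) (jv l))) (∑-cong b (λ l → cong₂ _*_ (iu′ l) (jv′ l))))

    mulTranspose-block-↑ˡ↑ˡ : ∀ x y → mulTranspose (a ℕ.+ b) M (x ↑ˡ b) (y ↑ˡ b) ≡ gram A A x y + gram B B x y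
    mulTranspose-block-↑ˡ↑ˡ x y =
      mulTranspose-splitAt _ _ (block-↑ˡ↑ˡ x) (block-↑ˡ↑ˡ y) (block-↑ˡ↑ʳ x) (block-↑ˡ↑ʳ y)

    mulTranspose-block-↑ˡ↑ʳ : ∀ x y → mulTranspose (a ℕ.+ b) M (x ↑ˡ b) (a ↑ʳ y) ≡ gram A C x y + gram B D x y
    mulTranspose-block-↑ˡ↑ʳ x y =
      mulTranspose-splitAt _ _ (block-↑ˡ↑ˡ x) (block-↑ʳ↑ˡ y) (block-↑ˡ↑ʳ x) (block-↑ʳ↑ʳ y)

    mulTranspose-block-↑ʳ↑ˡ : ∀ x y → mulTranspose (a ℕ.+ b) M (a ↑ʳ x) (y ↑ˡ b) ≡ gram C A x y + gram D B x y
    mulTranspose-block-↑ʳ↑ˡ x y =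
      mulTranspose-splitAt _ _ (block-↑ʳ↑ˡ x) (block-↑ˡ↑ˡ y) (block-↑ʳ↑ʳ x) (block-↑ˡ↑ʳ y)

    mulTranspose-block-↑ʳ↑ʳ : ∀ x y → mulTranspose (a ℕ.+ b) M (a ↑ʳ x) (a ↑ʳ y) ≡ gram C C x y + gram D D x y
    mulTranspose-block-↑ʳ↑ʳ x y =
      mulTranspose-splitAt _ _ (block-↑ʳ↑ˡ x) (block-↑ʳ↑ˡ y) (block-↑ʳ↑ʳ x) (block-↑ʳ↑ʳ y)

    block-isTernary : IsTernaryBlock A → IsTernaryBlock B → IsTernaryBlock C → IsTernaryBlock D →
      ∀ i j → IsTernary (M i j)
    block-isTernary tA tB tC tD = +-elim a b _
      (λ x → +-elim a b _ (λ y → subst IsTernary (sym (block-↑ˡ↑ˡ x y)) (tA x y))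
                          (λ y → subst IsTernary (sym (block-↑ˡ↑ʳ x y)) (tB x y)))
      (λ x → +-elim a b _ (λ y → subst IsTernary (sym (block-↑ʳ↑ˡ x y)) (tC x y))
                          (λ y → subst IsTernary (sym (block-↑ʳ↑ʳ x y)) (tD x y)))

    block-isSymmetric : IsSymmetric a A → IsSymmetric b D → (∀ x y → C y x ≡ B x y) → IsSymmetric (a ℕ.+ b) M
    block-isSymmetric sA sD C≡Bᵀ = +-elim a b _
      (λ x → +-elim a b _ (λ y → trans (block-↑ˡ↑ˡ x y) (trans (sA x y) (sym (block-↑ˡ↑ˡ y x))))
                          (λ y → trans (block-↑ˡ↑ʳ x y) (trans (sym (C≡Bᵀ x y)) (sym (block-↑ʳ↑ˡ y x)))))
      (λ x → +-elim a b _ (λ y → trans (block-↑ʳ↑ˡ x y) (trans (C≡Bᵀ y x) (sym (block-↑ˡ↑ʳ y x))))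
                          (λ y → trans (block-↑ʳ↑ʳ x y) (trans (sD x y) (sym (block-↑ʳ↑ʳ y x)))))

    block-mulTranspose : ∀ k →
      (∀ x y → gram A A x y + gram B B x y ≡ scaledId a k x y) →
      (∀ x y → gram A C x y + gram B D x y ≡ 0ℤ) →
      (∀ x y → gram C C x y + gram D D x y ≡ scaledId b k x y) →
      ∀ i j → mulTranspose (a ℕ.+ b) M i j ≡ scaledId (a ℕ.+ b) k i j
    block-mulTranspose k upper offDiagonal lower = +-elim a b _
      (λ x → +-elim a b _
        (λ y → trans (mulTranspose-block-↑ˡ↑ˡ x y)
                     (trans (upper x y) (sym (scaledId-injective k (FP.↑ˡ-injective b _ _) x y))))
        (λ y → trans (mulTranspose-block-↑ˡ↑ʳ x y)
                     (trans (offDiagonal x y) (sym (scaledId-≢ k (↑ˡ≢↑ʳ x y))))))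
      (λ x → +-elim a b _
        (λ y → trans (mulTranspose-block-↑ʳ↑ˡ x y)
                     (trans (cong₂ _+_ (gram-swap C A x y) (gram-swap D B x y))
                     (trans (offDiagonal y x) (sym (scaledId-≢ k (↑ˡ≢↑ʳ y x ∘ sym))))))
        (λ y → trans (mulTranspose-block-↑ʳ↑ʳ x y)
                     (trans (lower x y) (sym (scaledId-injective k (FP.↑ʳ-injective a _ _) x y)))))

  symmetricWeighing-0 : ∀ k → SymmetricWeighingMatrix 0 k
  symmetricWeighing-0 k = (λ ()) , ((λ ()) , (λ ())) , (λ ())

  infixr 6 _⊕_

  _⊕_ : ∀ {a b k} → SymmetricWeighingMatrix a k → SymmetricWeighingMatrix b k → SymmetricWeighingMatrix (a ℕ.+ b) k
  _⊕_ {a} {b} {k} (A , (tA , oA) , sA) (B , (tB , oB) , sB) =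
    block A O O′ B , (ternary , block-mulTranspose A O O′ B k upper offDiagonal lower) , symmetric
    where
    O : Block a b
    O _ _ = 0ℤ
    O′ : Block b a
    O′ _ _ = 0ℤ
    ternary = block-isTernary A O O′ B tA (λ _ _ → inj₁ refl) (λ _ _ → inj₁ refl) tB
    symmetric = block-isSymmetric A O O′ B sA sB (λ _ _ → refl)
    upper : ∀ x y → gram A A x y + gram O O x y ≡ scaledId a k x y
    upper x y = trans (cong (_+_ (gram A A x y)) (gram-zeroˡ O x y)) (trans (ℤP.+-identityʳ _) (oA x y))
    offDiagonal : ∀ x y → gram A O′ x y + gram O B x y ≡ 0ℤ
    offDiagonal x y = cong₂ _+_ (gram-zeroʳ A x y) (gram-zeroˡ B x y)
    lower : ∀ x y → gram O′ O′ x y + gram B B x y ≡ scaledId b k x y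
    lower x y = trans (cong (_+ gram B B x y) (gram-zeroˡ O′ x y)) (trans (ℤP.+-identityˡ _) (oB x y))

  replicate : ∀ {a k} c → SymmetricWeighingMatrix a k → SymmetricWeighingMatrix (c ℕ.* a) k
  replicate {k = k} zero    W = symmetricWeighing-0 k
  replicate         (suc c) W = W ⊕ replicate c W

  double : ∀ {n w} → SymmetricWeighingMatrix n w → SymmetricWeighingMatrix (n ℕ.+ n) (w ℕ.+ 1)
  double {n} {w} (A , (tA , oA) , sA) =
    block A I I −A , (ternary , block-mulTranspose A I I −A (w ℕ.+ 1) upper offDiagonal lower) , symmetric
    where
    I = scaledId n 1
    −A : Block n n
    −A x y = - A x y
    ternary = block-isTernary A I I −A tA scaledId-ternary scaledId-ternary (λ x y → ternary-neg (tA x y))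
    symmetric = block-isSymmetric A I I −A sA (λ x y → cong -_ (sA x y)) (λ x y → scaledId-sym 1 y x)
    gram-II : ∀ x y → gram I I x y ≡ I x y
    gram-II x y = trans (gram-idˡ I x y) (scaledId-sym 1 y x)
    upper : ∀ x y → gram A A x y + gram I I x y ≡ scaledId n (w ℕ.+ 1) x y
    upper x y = trans (cong₂ _+_ (oA x y) (gram-II x y)) (scaledId-+ w 1 x y)
    offDiagonal : ∀ x y → gram A I x y + gram I −A x y ≡ 0ℤ
    offDiagonal x y = begin
      gram A I x y + gram I −A x y  ≡⟨ cong₂ _+_ (gram-idʳ A x y) (gram-idˡ −A x y) ⟩
      A x y + - A y x               ≡⟨ cong (λ z → A x y + - z) (sA y x) ⟩
      A x y + - A x y               ≡⟨ ℤP.+-inverseʳ (A x y) ⟩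
      0ℤ                            ∎
      where open ≡-Reasoning
    lower : ∀ x y → gram I I x y + gram −A −A x y ≡ scaledId n (w ℕ.+ 1) x y
    lower x y = trans (ℤP.+-comm (gram I I x y) (gram −A −A x y))
      (trans (cong₂ _+_ (trans (gram-neg A A x y) (oA x y)) (gram-II x y)) (scaledId-+ w 1 x y))

  symmetricWeighing-1 : SymmetricWeighingMatrix 1 1
  symmetricWeighing-1 = (λ _ _ → 1ℤ) , ((λ _ _ → inj₂ (inj₁ refl)) , (λ { zero zero → refl })) , (λ _ _ → refl)

  symmetricWeighing-2^ : ∀ j → SymmetricWeighingMatrix (2 ℕ.^ j) (suc j)
  symmetricWeighing-2^ zero    = symmetricWeighing-1
  symmetricWeighing-2^ (suc j) =
    subst₂ SymmetricWeighingMatrix (cong (2 ℕ.^ j ℕ.+_) (sym (ℕP.+-identityʳ (2 ℕ.^ j)))) (ℕP.+-comm (suc j) 1)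
      (double (symmetricWeighing-2^ j))

  kronecker : ∀ {a b} → Matrix a → Matrix b → Matrix (a ℕ.* b)
  kronecker {a} {b} A B i j =
    A (proj₁ (remQuot {a} b i)) (proj₁ (remQuot {a} b j)) * B (proj₂ (remQuot {a} b i)) (proj₂ (remQuot {a} b j))

  kronecker-combine : ∀ {a b} (A : Matrix a) (B : Matrix b) i₁ i₂ j₁ j₂ →
    kronecker A B (combine i₁ i₂) (combine j₁ j₂) ≡ A i₁ j₁ * B i₂ j₂
  kronecker-combine {a} {b} A B i₁ i₂ j₁ j₂ =
    cong₂ (λ r s → A (proj₁ r) (proj₁ s) * B (proj₂ r) (proj₂ s))
          (FP.remQuot-combine {a} {b} i₁ i₂) (FP.remQuot-combine {a} {b} j₁ j₂)

  *-elim : ∀ {ℓ} a b (P : Fin (a ℕ.* b) → Set ℓ) → (∀ i j → P (combine i j)) → ∀ i → P i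
  *-elim a b P h i = subst P (FP.combine-remQuot {a} b i) (h (proj₁ (remQuot {a} b i)) (proj₂ (remQuot {a} b i)))

  mulTranspose-kronecker : ∀ {a b} (A : Matrix a) (B : Matrix b) i₁ i₂ j₁ j₂ →
    mulTranspose (a ℕ.* b) (kronecker A B) (combine i₁ i₂) (combine j₁ j₂) ≡
    mulTranspose a A i₁ j₁ * mulTranspose b B i₂ j₂
  mulTranspose-kronecker {a} {b} A B i₁ i₂ j₁ j₂ = begin
    ∑ (a ℕ.* b) (λ l → K (combine i₁ i₂) l * K (combine j₁ j₂) l)
      ≡⟨ ∑-combine a b _ ⟩
    ∑ a (λ l₁ → ∑ b (λ l₂ → K (combine i₁ i₂) (combine l₁ l₂) * K (combine j₁ j₂) (combine l₁ l₂)))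
      ≡⟨ ∑-cong a (λ l₁ → ∑-cong b (λ l₂ →
           trans (cong₂ _*_ (kronecker-combine A B i₁ i₂ l₁ l₂) (kronecker-combine A B j₁ j₂ l₁ l₂))
                 (interchange (A i₁ l₁) (B i₂ l₂) (A j₁ l₁) (B j₂ l₂)))) ⟩
    ∑ a (λ l₁ → ∑ b (λ l₂ → (A i₁ l₁ * A j₁ l₁) * (B i₂ l₂ * B j₂ l₂)))
      ≡⟨ ∑-*-∑ a b _ _ ⟨
    mulTranspose a A i₁ j₁ * mulTranspose b B i₂ j₂ ∎
    where
    open ≡-Reasoning
    K = kronecker A B
    interchange : ∀ x y z w → (x * y) * (z * w) ≡ (x * z) * (y * w)
    interchange = solve-∀

  infixr 7 _⊗_

  _⊗_ : ∀ {a b k l} → SymmetricWeighingMatrix a k → SymmetricWeighingMatrix b l →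
    SymmetricWeighingMatrix (a ℕ.* b) (k ℕ.* l)
  _⊗_ {a} {b} {k} {l} (A , (tA , oA) , sA) (B , (tB , oB) , sB) =
    kronecker A B , (ternary , orthogonal) , symmetric
    where
    ternary : ∀ i j → IsTernary (kronecker A B i j)
    ternary i j = ternary-* (tA _ _) (tB _ _)
    symmetric : IsSymmetric (a ℕ.* b) (kronecker A B)
    symmetric i j = cong₂ _*_ (sA _ _) (sB _ _)
    orthogonal : ∀ i j → mulTranspose (a ℕ.* b) (kronecker A B) i j ≡ scaledId (a ℕ.* b) (k ℕ.* l) i j
    orthogonal = *-elim a b _ λ i₁ i₂ → *-elim a b _ λ j₁ j₂ →
      trans (mulTranspose-kronecker A B i₁ i₂ j₁ j₂)
            (trans (cong₂ _*_ (oA i₁ j₁) (oB i₂ j₂)) (sym (scaledId-combine k l i₁ j₁ i₂ j₂)))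

  everywhere : ∀ {n} {P : Fin n → Fin n → Set} (P? : ∀ i j → Dec (P i j)) →
    {_ : True (FP.all? λ i → FP.all? λ j → P? i j)} → ∀ i j → P i j
  everywhere P? {holds} = toWitness holds

  isTernary? : ∀ x → Dec (IsTernary x)
  isTernary? x = x ℤ.≟ 0ℤ ⊎-dec (x ℤ.≟ 1ℤ ⊎-dec x ℤ.≟ -1ℤ)

  symmetricWeighing-7-4 : SymmetricWeighingMatrix 7 4
  symmetricWeighing-7-4 = W , (ternary , orthogonal) , symmetric
    where
    W : Matrix 7
    W i j = lookup (lookup rows i) j
      where
      rows : Vec (Vec ℤ 7) 7
      rows = ( 0ℤ ∷  0ℤ ∷  1ℤ ∷  0ℤ ∷  1ℤ ∷  1ℤ ∷ -1ℤ ∷ [])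
           ∷ ( 0ℤ ∷  1ℤ ∷  0ℤ ∷  1ℤ ∷  1ℤ ∷ -1ℤ ∷  0ℤ ∷ [])
           ∷ ( 1ℤ ∷  0ℤ ∷  1ℤ ∷  1ℤ ∷ -1ℤ ∷  0ℤ ∷  0ℤ ∷ [])
           ∷ ( 0ℤ ∷  1ℤ ∷  1ℤ ∷ -1ℤ ∷  0ℤ ∷  0ℤ ∷  1ℤ ∷ [])
           ∷ ( 1ℤ ∷  1ℤ ∷ -1ℤ ∷  0ℤ ∷  0ℤ ∷  1ℤ ∷  0ℤ ∷ [])
           ∷ ( 1ℤ ∷ -1ℤ ∷  0ℤ ∷  0ℤ ∷  1ℤ ∷  0ℤ ∷  1ℤ ∷ [])
           ∷ (-1ℤ ∷  0ℤ ∷  0ℤ ∷  1ℤ ∷  0ℤ ∷  1ℤ ∷  1ℤ ∷ [])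
           ∷ []
    ternary = everywhere (λ i j → isTernary? (W i j))
    orthogonal = everywhere (λ i j → mulTranspose 7 W i j ℤ.≟ scaledId 7 4 i j)
    symmetric = everywhere (λ i j → W i j ℤ.≟ W j i)

open Matrices

-- p = 3 + r ranges over the odd primes, and Fin p is visibly a successor type.
module OddPrime (r : ℕ) (p-prime : Prime (3 ℕ.+ r)) where

  import Data.Nat.Divisibility as ℕD
  open import Data.Nat.Primality using (euclidsLemma)
  open import Data.Nat.Coprimality using (coprime-Bézout; prime⇒coprime)
  open import Data.Nat.GCD using (module Bézout)
  open import Data.Integer as ℤ using (ℤ; +_; _+_; _-_; _*_; -_; 0ℤ; 1ℤ; -1ℤ)
  import Data.Integer.Properties as ℤP
  open import Data.Integer.DivMod using (_%ℕ_; _/ℕ_; n%ℕd<d; a≡a%ℕn+[a/ℕn]*n)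
  open import Data.Integer.Divisibility.Signed as ℤD using (_∣_; divides; _∣?_)
  open import Data.Integer.Tactic.RingSolver using (solve-∀)
  open import Relation.Binary.Bundles using (Setoid)
  import Relation.Binary.Reasoning.Setoid as SetoidReasoning
  open import Relation.Binary.Core using (_Preserves_⟶_)
  open import Data.Fin.Permutation using (permutation)
  import Algebra.Properties.Semiring.Sum ℤP.+-*-semiring as Sum

  p : ℕ
  p = 3 ℕ.+ r

  P : ℤ
  P = + p

  p∣_ : ℤ → Set
  p∣ a = P ∣ a

  p∣0 : p∣ 0ℤ
  p∣0 = divides 0ℤ refl

  p∣-multiple : ∀ q → p∣ (q * P)
  p∣-multiple q = divides q refl

  p∣-+ : ∀ {a b} → p∣ a → p∣ b → p∣ (a + b)
  p∣-+ = ℤD.∣m∣n⇒∣m+n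

  p∣-neg : ∀ {a} → p∣ a → p∣ (- a)
  p∣-neg = ℤD.∣m⇒∣-m

  p∣-*ˡ : ∀ b {a} → p∣ a → p∣ (b * a)
  p∣-*ˡ b = ℤD.∣n⇒∣m*n b

  p∣-*ʳ : ∀ b {a} → p∣ a → p∣ (a * b)
  p∣-*ʳ b = ℤD.∣m⇒∣m*n b

  p∣? : ∀ a → Dec (p∣ a)
  p∣? a = P ∣? a

  p∣-* : ∀ {a b} → p∣ (a * b) → p∣ a ⊎ p∣ b
  p∣-* {a} {b} p∣ab with euclidsLemma ℤ.∣ a ∣ ℤ.∣ b ∣ p-prime (subst (p ℕD.∣_) (ℤP.abs-* a b) (ℤD.∣⇒∣ᵤ p∣ab))
  ... | inj₁ p∣a = inj₁ (ℤD.∣ᵤ⇒∣ p∣a)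
  ... | inj₂ p∣b = inj₂ (ℤD.∣ᵤ⇒∣ p∣b)

  p∣-square : ∀ {t} → p∣ (t * t) → p∣ t
  p∣-square = reduce ∘ p∣-*

  p∤-* : ∀ {a b} → ¬ p∣ a → ¬ p∣ b → ¬ p∣ (a * b)
  p∤-* p∤a p∤b = [ p∤a , p∤b ]′ ∘ p∣-*

  p∣-small : ∀ {d} → d ℕ.< p → p∣ (+ d) → d ≡ 0
  p∣-small {zero}  _   _    = refl
  p∣-small {suc d} d<p p∣d = ⊥-elim (ℕD.>⇒∤ d<p (ℤD.∣⇒∣ᵤ p∣d))

  p∤1 : ¬ p∣ 1ℤ
  p∤1 p∣1 with p∣-small {1} (ℕ.s≤s (ℕ.s≤s ℕ.z≤n)) p∣1
  ... | ()

  p∤2 : ¬ p∣ (+ 2)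
  p∤2 p∣2 with p∣-small {2} (ℕ.s≤s (ℕ.s≤s (ℕ.s≤s ℕ.z≤n))) p∣2
  ... | ()

  infix 4 _≈_

  record _≈_ (a b : ℤ) : Set where
    constructor mod
    field p∣difference : p∣ (a - b)

  open _≈_

  ≈-by : ∀ {a b} (q : ℤ) → a - b ≡ q * P → a ≈ b
  ≈-by q eq = mod (subst p∣_ (sym eq) (p∣-multiple q))

  ≈-reflexive : ∀ {a b} → a ≡ b → a ≈ b
  ≈-reflexive {a} refl = ≈-by 0ℤ (ℤP.+-inverseʳ a)

  ≈-refl : ∀ {a} → a ≈ a
  ≈-refl = ≈-reflexive refl

  ≈-sym : ∀ {a b} → a ≈ b → b ≈ a
  ≈-sym {a} {b} (mod p∣a-b) = mod (subst p∣_ (lemma a b) (p∣-neg p∣a-b))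
    where
    lemma : ∀ a b → - (a - b) ≡ b - a
    lemma = solve-∀

  ≈-trans : ∀ {a b c} → a ≈ b → b ≈ c → a ≈ c
  ≈-trans {a} {b} {c} (mod p∣a-b) (mod p∣b-c) = mod (subst p∣_ (lemma a b c) (p∣-+ p∣a-b p∣b-c))
    where
    lemma : ∀ a b c → (a - b) + (b - c) ≡ a - c
    lemma = solve-∀

  ≈-setoid : Setoid _ _
  ≈-setoid = record { _≈_ = _≈_ ; isEquivalence = record { refl = ≈-refl ; sym = ≈-sym ; trans = ≈-trans } }

  module ≈-Reasoning = SetoidReasoning ≈-setoid

  +-cong : ∀ {a b c d} → a ≈ b → c ≈ d → a + c ≈ b + d
  +-cong {a} {b} {c} {d} (mod p∣a-b) (mod p∣c-d) = mod (subst p∣_ (lemma a b c d) (p∣-+ p∣a-b p∣c-d))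
    where
    lemma : ∀ a b c d → (a - b) + (c - d) ≡ (a + c) - (b + d)
    lemma = solve-∀

  *-cong : ∀ {a b c d} → a ≈ b → c ≈ d → a * c ≈ b * d
  *-cong {a} {b} {c} {d} (mod p∣a-b) (mod p∣c-d) = mod (subst p∣_ (lemma a b c d) (p∣-+ (p∣-*ʳ c p∣a-b) (p∣-*ˡ b p∣c-d)))
    where
    lemma : ∀ a b c d → (a - b) * c + b * (c - d) ≡ a * c - b * d
    lemma = solve-∀

  neg-cong : ∀ {a b} → a ≈ b → - a ≈ - b
  neg-cong {a} {b} (mod p∣a-b) = mod (subst p∣_ (lemma a b) (p∣-neg p∣a-b))
    where
    lemma : ∀ a b → - (a - b) ≡ - a - - b
    lemma = solve-∀

  p∣-resp : ∀ {a b} → a ≈ b → p∣ a → p∣ b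
  p∣-resp {a} {b} (mod p∣a-b) p∣a = subst p∣_ (lemma a b) (p∣-+ p∣a (p∣-neg p∣a-b))
    where
    lemma : ∀ a b → a + - (a - b) ≡ b
    lemma = solve-∀

  toℤ : Fin p → ℤ
  toℤ t = + toℕ t

  residue : ℤ → Fin p
  residue a = F.fromℕ< (n%ℕd<d a p)

  ≈-residue : ∀ a → a ≈ toℤ (residue a)
  ≈-residue a rewrite FP.toℕ-fromℕ< (n%ℕd<d a p) = ≈-by (a /ℕ p) (begin
    a - + (a %ℕ p)                          ≡⟨ cong (_- + (a %ℕ p)) (a≡a%ℕn+[a/ℕn]*n a p) ⟩
    + (a %ℕ p) + (a /ℕ p) * P - + (a %ℕ p)  ≡⟨ cancel (+ (a %ℕ p)) ((a /ℕ p) * P) ⟩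
    (a /ℕ p) * P                            ∎)
    where
    open ≡-Reasoning
    cancel : ∀ x y → x + y - x ≡ y
    cancel = solve-∀

  ≈⇒≡-below-p : ∀ {m n} → m ℕ.≤ n → n ℕ.< p → + n ≈ + m → n ≡ m
  ≈⇒≡-below-p {m} {n} m≤n n<p (mod p∣n-m) = ℕP.≤-antisym (ℕP.m∸n≡0⇒m≤n n∸m≡0) m≤n
    where
    n∸m≡0 : n ℕ.∸ m ≡ 0
    n∸m≡0 = p∣-small (ℕP.≤-<-trans (ℕP.m∸n≤m n m) n<p)
              (subst p∣_ (trans (ℤP.m-n≡m⊖n n m) (ℤP.⊖-≥ m≤n)) p∣n-m)

  toℤ-injective : ∀ {s t} → toℤ s ≈ toℤ t → s ≡ t
  toℤ-injective {s} {t} s≈t with ℕP.≤-total (toℕ s) (toℕ t)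
  ... | inj₁ s≤t = FP.toℕ-injective (sym (≈⇒≡-below-p s≤t (FP.toℕ<n t) (≈-sym s≈t)))
  ... | inj₂ t≤s = FP.toℕ-injective (≈⇒≡-below-p t≤s (FP.toℕ<n s) s≈t)

  residue-cong : ∀ {a b} → a ≈ b → residue a ≡ residue b
  residue-cong {a} {b} a≈b = toℤ-injective (≈-trans (≈-sym (≈-residue a)) (≈-trans a≈b (≈-residue b)))

  residue-toℤ : ∀ t → residue (toℤ t) ≡ t
  residue-toℤ t = toℤ-injective (≈-sym (≈-residue (toℤ t)))

  private
    pos-+-* : ∀ c m n → + (c ℕ.+ m ℕ.* n) ≡ + c + + m * + n
    pos-+-* c m n = trans (ℤP.pos-+ c (m ℕ.* n)) (cong (_+_ (+ c)) (ℤP.pos-* m n))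

  inverse : ∀ {a} → ¬ p∣ a → Σ ℤ (λ b → a * b ≈ 1ℤ)
  inverse {a} p∤a with toℕ (residue a) in residue≡ | ≈-residue a
  ... | zero      | a≈0 = ⊥-elim (p∤a (p∣-resp (≈-sym a≈0) p∣0))
  ... | r′@(suc _) | a≈r′ with coprime-Bézout (prime⇒coprime p-prime (subst (ℕ._< p) residue≡ (FP.toℕ<n (residue a))))
  ...   | Bézout.+- x y 1+yr′≡xp = - + y , ≈-trans (*-cong a≈r′ ≈-refl) (≈-by (- + x) (begin
          + r′ * - + y - 1ℤ       ≡⟨ rearrange (+ r′) (+ y) ⟩
          - (1ℤ + + y * + r′)     ≡⟨ cong -_ (trans (sym (pos-+-* 1 y r′)) (trans (cong +_ 1+yr′≡xp) (ℤP.pos-* x p))) ⟩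
          - (+ x * P)             ≡⟨ ℤP.neg-distribˡ-* (+ x) P ⟩
          - + x * P               ∎))
    where
    open ≡-Reasoning
    rearrange : ∀ r y → r * - y - 1ℤ ≡ - (1ℤ + y * r)
    rearrange = solve-∀
  ...   | Bézout.-+ x y 1+xp≡yr′ = + y , ≈-trans (*-cong a≈r′ ≈-refl) (≈-by (+ x) (begin
          + r′ * + y - 1ℤ         ≡⟨ cong (_- 1ℤ) (ℤP.*-comm (+ r′) (+ y)) ⟩
          + y * + r′ - 1ℤ         ≡⟨ cong (_- 1ℤ) (trans (sym (pos-+-* 1 x p)) (trans (cong +_ 1+xp≡yr′) (ℤP.pos-* y r′))) ⟨
          1ℤ + + x * P - 1ℤ       ≡⟨ cancel (+ x * P) ⟩
          + x * P                 ∎))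
    where
    open ≡-Reasoning
    cancel : ∀ z → 1ℤ + z - 1ℤ ≡ z
    cancel = solve-∀

  ∑ₚ : (ℤ → ℤ) → ℤ
  ∑ₚ g = ∑ p (g ∘ toℤ)

  ∑ₚ-cong : ∀ {g h : ℤ → ℤ} → (∀ a → g a ≡ h a) → ∑ₚ g ≡ ∑ₚ h
  ∑ₚ-cong g≗h = ∑-cong p (g≗h ∘ toℤ)

  ∑ₚ-bijection : (φ ψ : ℤ → ℤ) → φ Preserves _≈_ ⟶ _≈_ → ψ Preserves _≈_ ⟶ _≈_ →
    (∀ a → φ (ψ a) ≈ a) → (∀ a → ψ (φ a) ≈ a) →
    ∀ g → g Preserves _≈_ ⟶ _≡_ → ∑ₚ (g ∘ φ) ≡ ∑ₚ g
  ∑ₚ-bijection φ ψ φ-cong ψ-cong φψ≈id ψφ≈id g g-cong = begin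
    ∑ p (λ t → g (φ (toℤ t)))     ≡⟨ ∑-cong p (λ t → g-cong (≈-residue (φ (toℤ t)))) ⟩
    ∑ p (g ∘ toℤ ∘ φ̂)             ≡⟨ ∑≡sum p (g ∘ toℤ ∘ φ̂) ⟩
    Sum.sum (g ∘ toℤ ∘ φ̂)         ≡⟨ Sum.∑-permute (g ∘ toℤ) (permutation φ̂ ψ̂ φ̂ψ̂≗id ψ̂φ̂≗id) ⟨
    Sum.sum (g ∘ toℤ)             ≡⟨ ∑≡sum p (g ∘ toℤ) ⟨
    ∑ p (g ∘ toℤ)                 ∎
    where
    open ≡-Reasoning
    φ̂ ψ̂ : Fin p → Fin p
    φ̂ t = residue (φ (toℤ t))
    ψ̂ t = residue (ψ (toℤ t))
    φ̂ψ̂≗id : ∀ t → φ̂ (ψ̂ t) ≡ t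
    φ̂ψ̂≗id t = trans (residue-cong (≈-trans (φ-cong (≈-sym (≈-residue _))) (φψ≈id (toℤ t)))) (residue-toℤ t)
    ψ̂φ̂≗id : ∀ t → ψ̂ (φ̂ t) ≡ t
    ψ̂φ̂≗id t = trans (residue-cong (≈-trans (ψ-cong (≈-sym (≈-residue _))) (ψφ≈id (toℤ t)))) (residue-toℤ t)

  ∑ₚ-translate : ∀ c g → g Preserves _≈_ ⟶ _≡_ → ∑ₚ (λ a → g (a + c)) ≡ ∑ₚ g
  ∑ₚ-translate c = ∑ₚ-bijection (_+ c) (_- c) (λ a≈b → +-cong a≈b ≈-refl) (λ a≈b → +-cong a≈b ≈-refl)
    (λ a → ≈-reflexive (a-c+c a c)) (λ a → ≈-reflexive (a+c-c a c))
    where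
    a-c+c : ∀ a c → a - c + c ≡ a
    a-c+c = solve-∀
    a+c-c : ∀ a c → a + c - c ≡ a
    a+c-c = solve-∀

  ∑ₚ-dilate : ∀ {l} → ¬ p∣ l → ∀ g → g Preserves _≈_ ⟶ _≡_ → ∑ₚ (λ a → g (l * a)) ≡ ∑ₚ g
  ∑ₚ-dilate {l} p∤l with inverse p∤l
  ... | m , lm≈1 = ∑ₚ-bijection (l *_) (m *_) (*-cong (≈-refl {l})) (*-cong (≈-refl {m}))
    (λ a → cancel (l * (m * a)) (sym (ℤP.*-assoc l m a)))
    (λ a → cancel (m * (l * a)) (trans (sym (ℤP.*-assoc m l a)) (cong (_* a) (ℤP.*-comm m l))))
    where
    cancel : ∀ {a} z → z ≡ l * m * a → z ≈ a
    cancel {a} z z≡lma = ≈-trans (≈-reflexive z≡lma) (≈-trans (*-cong lm≈1 ≈-refl) (≈-reflexive (ℤP.*-identityˡ a)))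

  p∤toℤ-suc : ∀ (i : Fin (2 ℕ.+ r)) → ¬ p∣ toℤ (suc i)
  p∤toℤ-suc i p∣i+1 with p∣-small (FP.toℕ<n (suc i)) p∣i+1
  ... | ()

  P₋₁ : ℤ
  P₋₁ = + (2 ℕ.+ r)

  ∑ₚ-units : ∀ g c → (∀ u → ¬ p∣ u → g u ≡ c) → ∑ₚ g ≡ g 0ℤ + P₋₁ * c
  ∑ₚ-units g c g≡c = cong (_+_ (g 0ℤ)) (trans (∑-cong (2 ℕ.+ r) (λ i → g≡c _ (p∤toℤ-suc i))) (∑-const (2 ℕ.+ r) c))

  [p∣_] : ℤ → ℤ
  [p∣ a ] with p∣? a
  ... | yes _ = 1ℤ
  ... | no  _ = 0ℤ

  [p∣]-yes : ∀ {a} → p∣ a → [p∣ a ] ≡ 1ℤ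
  [p∣]-yes {a} p∣a with p∣? a
  ... | yes _   = refl
  ... | no  p∤a = ⊥-elim (p∤a p∣a)

  [p∣]-no : ∀ {a} → ¬ p∣ a → [p∣ a ] ≡ 0ℤ
  [p∣]-no {a} p∤a with p∣? a
  ... | yes p∣a = ⊥-elim (p∤a p∣a)
  ... | no  _   = refl

  [p∣]-⇔ : ∀ {a b} → (p∣ a → p∣ b) → (p∣ b → p∣ a) → [p∣ a ] ≡ [p∣ b ]
  [p∣]-⇔ {a} {b} a⇒b b⇒a with p∣? a
  ... | yes p∣a = sym ([p∣]-yes (a⇒b p∣a))
  ... | no  p∤a = sym ([p∣]-no (p∤a ∘ b⇒a))

  [p∣]-cong : [p∣_] Preserves _≈_ ⟶ _≡_
  [p∣]-cong a≈b = [p∣]-⇔ (p∣-resp a≈b) (p∣-resp (≈-sym a≈b))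

  [p∣]-swap : ∀ x y → [p∣ x - y ] ≡ [p∣ y - x ]
  [p∣]-swap x y = [p∣]-⇔ (subst p∣_ (swap x y) ∘ p∣-neg) (subst p∣_ (swap y x) ∘ p∣-neg)
    where
    swap : ∀ x y → - (x - y) ≡ y - x
    swap = solve-∀

  ∑ₚ-[p∣] : ∀ c → ∑ₚ (λ a → [p∣ a - c ]) ≡ 1ℤ
  ∑ₚ-[p∣] c = begin
    ∑ₚ (λ a → [p∣ a - c ])        ≡⟨ ∑ₚ-translate (- c) [p∣_] [p∣]-cong ⟩
    ∑ₚ [p∣_]                      ≡⟨ ∑ₚ-units [p∣_] 0ℤ (λ _ → [p∣]-no) ⟩
    [p∣ 0ℤ ] + P₋₁ * 0ℤ           ≡⟨ cong₂ _+_ ([p∣]-yes p∣0) (ℤP.*-zeroʳ P₋₁) ⟩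
    1ℤ                            ∎
    where open ≡-Reasoning

  IsSquare : ℤ → Set
  IsSquare a = Σ ℤ (λ s → s * s ≈ a)

  isSquare? : ∀ a → Dec (IsSquare a)
  isSquare? a with FP.any? (λ t → p∣? (toℤ t * toℤ t - a))
  ... | yes (t , p∣t²-a) = yes (toℤ t , mod p∣t²-a)
  ... | no  ¬root        = no λ (s , s²≈a) → ¬root (residue s , p∣difference
          (≈-trans (*-cong (≈-sym (≈-residue s)) (≈-sym (≈-residue s))) s²≈a))

  -- χ is opaque: unfolded, it is a sum of divisibility decisions that the conversion checker
  -- would try to evaluate on open terms.
  opaque
    -- χ a counts the square roots of a in 𝔽ₚ, minus one: this is the Legendre symbol,
    -- and summing the count over all a is a double count of 𝔽ₚ.
    χ : ℤ → ℤ
    χ a = ∑ₚ (λ t → [p∣ t * t - a ]) - 1ℤ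

    χ-cong : χ Preserves _≈_ ⟶ _≡_
    χ-cong a≈b = cong (_- 1ℤ) (∑-cong p (λ t → [p∣]-cong (+-cong (≈-refl {toℤ t * toℤ t}) (neg-cong a≈b))))

    χ-p∣ : ∀ {a} → p∣ a → χ a ≡ 0ℤ
    χ-p∣ {a} p∣a = cong (_- 1ℤ) (trans (∑-cong p λ t → [p∣]-⇔ (root⇒p∣ (toℤ t)) (p∣⇒root (toℤ t))) (∑ₚ-[p∣] 0ℤ))
      where
      p∣⇒root : ∀ t → p∣ (t - 0ℤ) → p∣ (t * t - a)
      p∣⇒root t p∣t = p∣-+ (p∣-*ˡ t (subst p∣_ (ℤP.+-identityʳ t) p∣t)) (p∣-neg p∣a)
      root⇒p∣ : ∀ t → p∣ (t * t - a) → p∣ (t - 0ℤ)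
      root⇒p∣ t p∣t²-a = subst p∣_ (sym (ℤP.+-identityʳ t)) (p∣-square (subst p∣_ (t²-a+a t a) (p∣-+ p∣t²-a p∣a)))
        where
        t²-a+a : ∀ t a → t * t - a + a ≡ t * t
        t²-a+a = solve-∀

    χ-square : ∀ {a} → ¬ p∣ a → IsSquare a → χ a ≡ 1ℤ
    χ-square {a} p∤a (s , s²≈a) = begin
      ∑ₚ (λ t → [p∣ t * t - a ]) - 1ℤ
        ≡⟨ cong (_- 1ℤ) (∑-cong p (roots ∘ toℤ)) ⟩
      ∑ₚ (λ t → [p∣ t - s ] + [p∣ t - - s ]) - 1ℤ
        ≡⟨ cong (_- 1ℤ) (∑-+ p (λ t → [p∣ toℤ t - s ]) (λ t → [p∣ toℤ t - - s ])) ⟩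
      ∑ₚ (λ t → [p∣ t - s ]) + ∑ₚ (λ t → [p∣ t - - s ]) - 1ℤ
        ≡⟨ cong (_- 1ℤ) (cong₂ _+_ (∑ₚ-[p∣] s) (∑ₚ-[p∣] (- s))) ⟩
      1ℤ + 1ℤ - 1ℤ
        ≡⟨⟩
      1ℤ ∎
      where
      open ≡-Reasoning
      p∤s : ¬ p∣ s
      p∤s p∣s = p∤a (p∣-resp s²≈a (p∣-*ˡ s p∣s))
      factor : ∀ t → t * t - a ≡ (t - s) * (t - - s) + (s * s - a)
      factor t = identity t s a
        where
        identity : ∀ t s a → t * t - a ≡ (t - s) * (t - - s) + (s * s - a)
        identity = solve-∀
      roots : ∀ t → [p∣ t * t - a ] ≡ [p∣ t - s ] + [p∣ t - - s ]
      roots t with p∣? (t - s) | p∣? (t - - s)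
      ... | yes p∣t-s | yes p∣t+s = ⊥-elim ([ p∤2 , p∤s ]′ (p∣-* (subst p∣_ (identity t s) (p∣-+ p∣t+s (p∣-neg p∣t-s)))))
        where
        identity : ∀ t s → (t - - s) + - (t - s) ≡ + 2 * s
        identity = solve-∀
      ... | yes p∣t-s | no _ = [p∣]-yes (subst p∣_ (sym (factor t)) (p∣-+ (p∣-*ʳ (t - - s) p∣t-s) (p∣difference s²≈a)))
      ... | no _ | yes p∣t+s = [p∣]-yes (subst p∣_ (sym (factor t)) (p∣-+ (p∣-*ˡ (t - s) p∣t+s) (p∣difference s²≈a)))
      ... | no p∤t-s | no p∤t+s = [p∣]-no λ p∣t²-a → p∤-* p∤t-s p∤t+s
            (subst p∣_ (identity t s a) (p∣-+ p∣t²-a (p∣-neg (p∣difference s²≈a))))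
        where
        identity : ∀ t s a → (t * t - a) + - (s * s - a) ≡ (t - s) * (t - - s)
        identity = solve-∀

    χ-nonsquare : ∀ {a} → ¬ IsSquare a → χ a ≡ -1ℤ
    χ-nonsquare {a} ¬□a = cong (_- 1ℤ) (trans (∑-cong p (λ t → [p∣]-no (λ p∣t²-a → ¬□a (toℤ t , mod p∣t²-a)))) (∑-zero p))

    ∑ₚ-χ : ∑ₚ χ ≡ 0ℤ
    ∑ₚ-χ = begin
      ∑ₚ (λ a → ∑ₚ (λ t → [p∣ t * t - a ]) + -1ℤ)
        ≡⟨ ∑-+ p (λ a → ∑ₚ (λ t → [p∣ t * t - toℤ a ])) (λ _ → -1ℤ) ⟩
      ∑ₚ (λ a → ∑ₚ (λ t → [p∣ t * t - a ])) + ∑ₚ (λ _ → -1ℤ)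
        ≡⟨ cong₂ _+_ doubleCount (∑-const p -1ℤ) ⟩
      P + P * -1ℤ
        ≡⟨ identity P ⟩
      0ℤ ∎
      where
      open ≡-Reasoning
      identity : ∀ x → x + x * -1ℤ ≡ 0ℤ
      identity = solve-∀
      doubleCount : ∑ₚ (λ a → ∑ₚ (λ t → [p∣ t * t - a ])) ≡ P
      doubleCount = begin
        ∑ₚ (λ a → ∑ₚ (λ t → [p∣ t * t - a ]))   ≡⟨ ∑-comm p p (λ a t → [p∣ toℤ t * toℤ t - toℤ a ]) ⟩
        ∑ₚ (λ t → ∑ₚ (λ a → [p∣ t * t - a ]))   ≡⟨ ∑-cong p (λ t → trans (∑-cong p (λ a →
                                                      [p∣]-swap (toℤ t * toℤ t) (toℤ a)))
                                                    (∑ₚ-[p∣] (toℤ t * toℤ t))) ⟩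
        ∑ₚ (λ _ → 1ℤ)                           ≡⟨ ∑-const p 1ℤ ⟩
        P * 1ℤ                                  ≡⟨ ℤP.*-identityʳ P ⟩
        P                                       ∎

  data Classification (a : ℤ) : Set where
    divisible : p∣ a → Classification a
    square    : ¬ p∣ a → IsSquare a → Classification a
    nonsquare : ¬ p∣ a → ¬ IsSquare a → Classification a

  classify : ∀ a → Classification a
  classify a with p∣? a | isSquare? a
  ... | yes p∣a | _      = divisible p∣a
  ... | no p∤a  | yes □a = square p∤a □a
  ... | no p∤a  | no ¬□a = nonsquare p∤a ¬□a

  χ-ternary : ∀ a → IsTernary (χ a)
  χ-ternary a with classify a
  ... | divisible p∣a    = inj₁ (χ-p∣ p∣a)
  ... | square p∤a □a    = inj₂ (inj₁ (χ-square p∤a □a))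
  ... | nonsquare _ ¬□a  = inj₂ (inj₂ (χ-nonsquare ¬□a))

  χ²-unit : ∀ {a} → ¬ p∣ a → χ a * χ a ≡ 1ℤ
  χ²-unit {a} p∤a with classify a
  ... | divisible p∣a   = ⊥-elim (p∤a p∣a)
  ... | square _ □a     = cong₂ _*_ (χ-square p∤a □a) (χ-square p∤a □a)
  ... | nonsquare _ ¬□a = cong₂ _*_ (χ-nonsquare ¬□a) (χ-nonsquare ¬□a)

  IsSquare-* : ∀ {a b} → IsSquare a → IsSquare b → IsSquare (a * b)
  IsSquare-* (s , s²≈a) (u , u²≈b) = s * u , ≈-trans (≈-reflexive (interchange s u)) (*-cong s²≈a u²≈b)
    where
    interchange : ∀ s u → (s * u) * (s * u) ≡ (s * s) * (u * u)
    interchange = solve-∀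

  IsSquare-cancelˡ : ∀ {a b} → ¬ p∣ a → IsSquare a → IsSquare (a * b) → IsSquare b
  IsSquare-cancelˡ {a} {b} p∤a (s , s²≈a) (u , u²≈ab) with inverse (λ p∣s → p∤a (p∣-resp s²≈a (p∣-*ˡ s p∣s)))
  ... | m , sm≈1 = u * m , (begin
    (u * m) * (u * m)        ≡⟨ i₁ u m ⟩
    (u * u) * (m * m)        ≈⟨ *-cong u²≈ab ≈-refl ⟩
    (a * b) * (m * m)        ≈⟨ *-cong (*-cong (≈-sym s²≈a) ≈-refl) ≈-refl ⟩
    ((s * s) * b) * (m * m)  ≡⟨ i₂ s b m ⟩
    ((s * m) * (s * m)) * b  ≈⟨ *-cong (*-cong sm≈1 sm≈1) ≈-refl ⟩
    (1ℤ * 1ℤ) * b            ≡⟨ ℤP.*-identityˡ b ⟩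
    b                        ∎)
    where
    open ≈-Reasoning
    i₁ : ∀ u m → (u * m) * (u * m) ≡ (u * u) * (m * m)
    i₁ = solve-∀
    i₂ : ∀ s b m → ((s * s) * b) * (m * m) ≡ ((s * m) * (s * m)) * b
    i₂ = solve-∀

  ∑ₚ-penalty : ∀ {n} → ¬ p∣ n → ¬ IsSquare n → ∑ₚ (λ t → penalty (χ t) (χ (n * t))) ≡ 0ℤ
  ∑ₚ-penalty {n} p∤n ¬□n = begin
    ∑ₚ (λ t → penalty (χ t) (χ (n * t)))      ≡⟨ ∑ₚ-cong pointwise ⟩
    ∑ₚ (λ t → - (+ 2) * (χ t + χ (n * t)))    ≡⟨ ∑-*ˡ p (- (+ 2)) (λ t → χ (toℤ t) + χ (n * toℤ t)) ⟩
    - (+ 2) * ∑ₚ (λ t → χ t + χ (n * t))      ≡⟨ cong (- (+ 2) *_) (∑-+ p (χ ∘ toℤ) (λ t → χ (n * toℤ t))) ⟩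
    - (+ 2) * (∑ₚ χ + ∑ₚ (λ t → χ (n * t)))   ≡⟨ cong (λ x → - (+ 2) * (∑ₚ χ + x)) (∑ₚ-dilate p∤n χ χ-cong) ⟩
    - (+ 2) * (∑ₚ χ + ∑ₚ χ)                   ≡⟨ cong (λ x → - (+ 2) * (x + x)) ∑ₚ-χ ⟩
    0ℤ                                        ∎
    where
    open ≡-Reasoning
    pointwise : ∀ t → penalty (χ t) (χ (n * t)) ≡ - (+ 2) * (χ t + χ (n * t))
    pointwise t with classify t
    ... | divisible p∣t = penalty-linear (inj₁ (χ-p∣ p∣t , χ-p∣ (p∣-*ˡ n p∣t)))
    ... | square p∤t □t = penalty-linear (inj₂ (inj₁ (χ-square p∤t □t ,
            χ-nonsquare (¬□n ∘ IsSquare-cancelˡ p∤t □t ∘ subst IsSquare (ℤP.*-comm n t)))))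
    ... | nonsquare _ ¬□t = penalty-linear (inj₂ (inj₂ (χ-nonsquare ¬□t)))

  -- The penalties are non-negative with total zero, so each vanishes; at t = a (χ a = −1)
  -- the penalty is 2 (1 − χ (n a)).
  χ-nonsquare-* : ∀ {n a} → ¬ p∣ n → ¬ IsSquare n → ¬ IsSquare a → χ (n * a) ≡ 1ℤ
  χ-nonsquare-* {n} {a} p∤n ¬□n ¬□a = trans (χ-cong (*-cong (≈-refl {n}) (≈-residue a)))
    (forced (χ-ternary (n * t₀)) (subst (λ x → penalty x (χ (n * t₀)) ≡ 0ℤ) χt₀≡-1 (penalty≡0 (residue a))))
    where
    t₀ = toℤ (residue a)
    χt₀≡-1 : χ t₀ ≡ -1ℤ
    χt₀≡-1 = trans (χ-cong (≈-sym (≈-residue a))) (χ-nonsquare ¬□a)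
    penalty≡0 : ∀ t → penalty (χ (toℤ t)) (χ (n * toℤ t)) ≡ 0ℤ
    penalty≡0 = ∑-nonneg-≡0 p _ (λ t → penalty-nonneg (χ-ternary (toℤ t)) (χ-ternary (n * toℤ t))) (∑ₚ-penalty p∤n ¬□n)
    forced : ∀ {y} → IsTernary y → penalty -1ℤ y ≡ 0ℤ → y ≡ 1ℤ
    forced (inj₁ refl) ()
    forced (inj₂ (inj₁ refl)) _ = refl
    forced (inj₂ (inj₂ refl)) ()

  χ-* : ∀ a b → χ (a * b) ≡ χ a * χ b
  χ-* a b with classify a | classify b
  ... | divisible p∣a | _ =
    trans (χ-p∣ (p∣-*ʳ b p∣a)) (sym (trans (cong (_* χ b) (χ-p∣ p∣a)) (ℤP.*-zeroˡ (χ b))))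
  ... | square _ _ | divisible p∣b =
    trans (χ-p∣ (p∣-*ˡ a p∣b)) (sym (trans (cong (χ a *_) (χ-p∣ p∣b)) (ℤP.*-zeroʳ (χ a))))
  ... | nonsquare _ _ | divisible p∣b =
    trans (χ-p∣ (p∣-*ˡ a p∣b)) (sym (trans (cong (χ a *_) (χ-p∣ p∣b)) (ℤP.*-zeroʳ (χ a))))
  ... | square p∤a □a | square p∤b □b =
    trans (χ-square (p∤-* p∤a p∤b) (IsSquare-* □a □b)) (sym (cong₂ _*_ (χ-square p∤a □a) (χ-square p∤b □b)))
  ... | square p∤a □a | nonsquare p∤b ¬□b =
    trans (χ-nonsquare (¬□b ∘ IsSquare-cancelˡ p∤a □a)) (sym (cong₂ _*_ (χ-square p∤a □a) (χ-nonsquare ¬□b)))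
  ... | nonsquare p∤a ¬□a | square p∤b □b =
    trans (χ-nonsquare (¬□a ∘ IsSquare-cancelˡ p∤b □b ∘ subst IsSquare (ℤP.*-comm a b)))
          (sym (cong₂ _*_ (χ-nonsquare ¬□a) (χ-square p∤b □b)))
  ... | nonsquare p∤a ¬□a | nonsquare _ ¬□b =
    trans (χ-nonsquare-* p∤a ¬□a ¬□b) (sym (cong₂ _*_ (χ-nonsquare ¬□a) (χ-nonsquare ¬□b)))

  record ℤ³ : Set where
    constructor ⟨_,_,_⟩
    field x₁ x₂ x₃ : ℤ

  infixl 7 _·_
  infixl 6 _+³_
  infixr 8 _•_

  _·_ : ℤ³ → ℤ³ → ℤ
  ⟨ a , b , c ⟩ · ⟨ d , e , f ⟩ = a * d + b * e + c * f

  _+³_ : ℤ³ → ℤ³ → ℤ³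
  ⟨ a , b , c ⟩ +³ ⟨ d , e , f ⟩ = ⟨ a + d , b + e , c + f ⟩

  _•_ : ℤ → ℤ³ → ℤ³
  l • ⟨ a , b , c ⟩ = ⟨ l * a , l * b , l * c ⟩

  0³ : ℤ³
  0³ = ⟨ 0ℤ , 0ℤ , 0ℤ ⟩

  ·-comm : ∀ x y → x · y ≡ y · x
  ·-comm ⟨ a , b , c ⟩ ⟨ d , e , f ⟩ = identity a b c d e f
    where
    identity : ∀ a b c d e f → a * d + b * e + c * f ≡ d * a + e * b + f * c
    identity = solve-∀

  ·-zeroʳ : ∀ x → x · 0³ ≡ 0ℤ
  ·-zeroʳ ⟨ a , b , c ⟩ = identity a b c
    where
    identity : ∀ a b c → a * 0ℤ + b * 0ℤ + c * 0ℤ ≡ 0ℤ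
    identity = solve-∀

  ·-+³ʳ : ∀ x z d s → x · (z +³ s • d) ≡ x · z + s * (x · d)
  ·-+³ʳ ⟨ a , b , c ⟩ ⟨ z₁ , z₂ , z₃ ⟩ ⟨ d₁ , d₂ , d₃ ⟩ s = identity a b c z₁ z₂ z₃ d₁ d₂ d₃ s
    where
    identity : ∀ a b c z₁ z₂ z₃ d₁ d₂ d₃ s →
      a * (z₁ + s * d₁) + b * (z₂ + s * d₂) + c * (z₃ + s * d₃) ≡ a * z₁ + b * z₂ + c * z₃ + s * (a * d₁ + b * d₂ + c * d₃)
    identity = solve-∀

  ·-•ʳ : ∀ x l z → x · (l • z) ≡ l * (x · z)
  ·-•ʳ ⟨ a , b , c ⟩ l ⟨ z₁ , z₂ , z₃ ⟩ = identity a b c l z₁ z₂ z₃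
    where
    identity : ∀ a b c l z₁ z₂ z₃ → a * (l * z₁) + b * (l * z₂) + c * (l * z₃) ≡ l * (a * z₁ + b * z₂ + c * z₃)
    identity = solve-∀

  Congruent³ : (ℤ³ → ℤ) → Set
  Congruent³ G = ∀ {a b c a′ b′ c′} → a ≈ a′ → b ≈ b′ → c ≈ c′ → G ⟨ a , b , c ⟩ ≡ G ⟨ a′ , b′ , c′ ⟩

  ·-congʳ : ∀ x {a b c a′ b′ c′} → a ≈ a′ → b ≈ b′ → c ≈ c′ → x · ⟨ a , b , c ⟩ ≈ x · ⟨ a′ , b′ , c′ ⟩
  ·-congʳ ⟨ x₁ , x₂ , x₃ ⟩ a≈a′ b≈b′ c≈c′ =
    +-cong (+-cong (*-cong (≈-refl {x₁}) a≈a′) (*-cong (≈-refl {x₂}) b≈b′)) (*-cong (≈-refl {x₃}) c≈c′)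

  ∑³ : (ℤ³ → ℤ) → ℤ
  ∑³ G = ∑ₚ λ a → ∑ₚ λ b → ∑ₚ λ c → G ⟨ a , b , c ⟩

  ∑³-cong : ∀ {G H} → (∀ z → G z ≡ H z) → ∑³ G ≡ ∑³ H
  ∑³-cong G≗H = ∑ₚ-cong λ a → ∑ₚ-cong λ b → ∑ₚ-cong λ c → G≗H ⟨ a , b , c ⟩

  ∑³-translate : ∀ G → Congruent³ G → ∀ d → ∑³ (λ z → G (z +³ d)) ≡ ∑³ G
  ∑³-translate G G-cong ⟨ d₁ , d₂ , d₃ ⟩ = begin
    ∑ₚ (λ a → ∑ₚ λ b → ∑ₚ λ c → G ⟨ a + d₁ , b + d₂ , c + d₃ ⟩)
      ≡⟨ ∑ₚ-cong (λ a → ∑ₚ-cong λ b → ∑ₚ-translate d₃ (λ c → G ⟨ a + d₁ , b + d₂ , c ⟩)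
           λ c≈c′ → G-cong ≈-refl ≈-refl c≈c′) ⟩
    ∑ₚ (λ a → ∑ₚ λ b → ∑ₚ λ c → G ⟨ a + d₁ , b + d₂ , c ⟩)
      ≡⟨ ∑ₚ-cong (λ a → ∑ₚ-translate d₂ (λ b → ∑ₚ λ c → G ⟨ a + d₁ , b , c ⟩)
           λ b≈b′ → ∑ₚ-cong λ c → G-cong (≈-refl {a + d₁}) b≈b′ (≈-refl {c})) ⟩
    ∑ₚ (λ a → ∑ₚ λ b → ∑ₚ λ c → G ⟨ a + d₁ , b , c ⟩)
      ≡⟨ ∑ₚ-translate d₁ (λ a → ∑ₚ λ b → ∑ₚ λ c → G ⟨ a , b , c ⟩)
           (λ a≈a′ → ∑ₚ-cong λ b → ∑ₚ-cong λ c → G-cong a≈a′ (≈-refl {b}) (≈-refl {c})) ⟩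
    ∑³ G ∎
    where open ≡-Reasoning

  ∑³-const : ∀ c → ∑³ (λ _ → c) ≡ P * (P * (P * c))
  ∑³-const c = trans (∑-cong p λ _ → trans (∑-cong p λ _ → ∑-const p c) (∑-const p (P * c))) (∑-const p (P * (P * c)))

  ∑³-*ʳ : ∀ G c → ∑³ (λ z → G z * c) ≡ ∑³ G * c
  ∑³-*ʳ G c = trans
    (∑ₚ-cong λ a → trans (∑ₚ-cong λ b → ∑-*ʳ p c (λ c′ → G ⟨ a , b , toℤ c′ ⟩))
                         (∑-*ʳ p c (λ b → ∑ₚ λ c′ → G ⟨ a , toℤ b , c′ ⟩)))
    (∑-*ʳ p c (λ a → ∑ₚ λ b → ∑ₚ λ c′ → G ⟨ toℤ a , b , c′ ⟩))

  ∑ₚ-∑³ : ∀ (K : ℤ → ℤ³ → ℤ) → ∑ₚ (λ s → ∑³ (K s)) ≡ ∑³ (λ z → ∑ₚ (λ s → K s z))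
  ∑ₚ-∑³ K = trans (∑-comm p p (λ s a → ∑ₚ λ b → ∑ₚ λ c → K (toℤ s) ⟨ toℤ a , b , c ⟩))
    (∑ₚ-cong λ a → trans (∑-comm p p (λ s b → ∑ₚ λ c → K (toℤ s) ⟨ a , toℤ b , c ⟩))
    (∑ₚ-cong λ b → ∑-comm p p (λ s c → K (toℤ s) ⟨ a , b , toℤ c ⟩)))

  ·-shift : ∀ x z d s {c} → x · d ≈ c → x · (z +³ s • d) ≈ x · z + s * c
  ·-shift x z d s x·d≈c = ≈-trans (≈-reflexive (·-+³ʳ x z d s)) (+-cong (≈-refl {x · z}) (*-cong (≈-refl {s}) x·d≈c))

  -- Shifting z along a direction d with x · d = 1 and y · d = 0 moves x · z through all of 𝔽ₚ
  -- while fixing y · z.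
  ∑³-average : ∀ (u w : ℤ → ℤ) → u Preserves _≈_ ⟶ _≡_ → w Preserves _≈_ ⟶ _≡_ →
    ∀ x y d → x · d ≈ 1ℤ → y · d ≈ 0ℤ →
    P * ∑³ (λ z → u (x · z) * w (y · z)) ≡ ∑³ (λ z → w (y · z)) * ∑ₚ u
  ∑³-average u w u-cong w-cong x y d x·d≈1 y·d≈0 = begin
    P * ∑³ G                                          ≡⟨ ∑-const p (∑³ G) ⟨
    ∑ₚ (λ s → ∑³ G)                                   ≡⟨ ∑ₚ-cong (λ s → ∑³-translate G G-cong (s • d)) ⟨
    ∑ₚ (λ s → ∑³ (λ z → G (z +³ s • d)))              ≡⟨ ∑ₚ-cong (λ s → ∑³-cong λ z →
                                                           cong₂ _*_ (u-cong (shift-x s z)) (w-cong (shift-y s z))) ⟩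
    ∑ₚ (λ s → ∑³ (λ z → u (s + x · z) * w (y · z)))   ≡⟨ ∑ₚ-∑³ (λ s z → u (s + x · z) * w (y · z)) ⟩
    ∑³ (λ z → ∑ₚ (λ s → u (s + x · z) * w (y · z)))   ≡⟨ ∑³-cong (λ z → trans (∑-*ʳ p (w (y · z)) (λ s → u (toℤ s + x · z)))
                                                           (cong (_* w (y · z)) (∑ₚ-translate (x · z) u u-cong))) ⟩
    ∑³ (λ z → ∑ₚ u * w (y · z))                       ≡⟨ ∑³-cong (λ z → ℤP.*-comm (∑ₚ u) (w (y · z))) ⟩
    ∑³ (λ z → w (y · z) * ∑ₚ u)                       ≡⟨ ∑³-*ʳ (λ z → w (y · z)) (∑ₚ u) ⟩
    ∑³ (λ z → w (y · z)) * ∑ₚ u                       ∎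
    where
    open ≡-Reasoning
    G : ℤ³ → ℤ
    G z = u (x · z) * w (y · z)
    G-cong : Congruent³ G
    G-cong a≈a′ b≈b′ c≈c′ = cong₂ _*_ (u-cong (·-congʳ x a≈a′ b≈b′ c≈c′)) (w-cong (·-congʳ y a≈a′ b≈b′ c≈c′))
    shift-x : ∀ s z → x · (z +³ s • d) ≈ s + x · z
    shift-x s z = ≈-trans (·-shift x z d s x·d≈1)
      (≈-reflexive (trans (cong (_+_ (x · z)) (ℤP.*-identityʳ s)) (ℤP.+-comm (x · z) s)))
    shift-y : ∀ s z → y · (z +³ s • d) ≈ y · z
    shift-y s z = ≈-trans (·-shift y z d s y·d≈0)
      (≈-reflexive (trans (cong (_+_ (y · z)) (ℤP.*-zeroʳ s)) (ℤP.+-identityʳ (y · z))))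

  ∑ℙ² : (ℤ³ → ℤ) → ℤ
  ∑ℙ² f = ∑ₚ (λ a → ∑ₚ λ b → f ⟨ 1ℤ , a , b ⟩) + (f ⟨ 0ℤ , 0ℤ , 1ℤ ⟩ + ∑ₚ λ c → f ⟨ 0ℤ , 1ℤ , c ⟩)

  Homogeneous : (ℤ³ → ℤ) → Set
  Homogeneous G = ∀ {l} → ¬ p∣ l → ∀ z → G (l • z) ≡ G z

  module _ (G : ℤ³ → ℤ) (G-cong : Congruent³ G) (G-homogeneous : Homogeneous G) where

    private
      scale : ∀ {l} → ¬ p∣ l → ∀ a b c → G ⟨ l * a , l * b , l * c ⟩ ≡ G ⟨ a , b , c ⟩
      scale p∤l a b c = G-homogeneous p∤l ⟨ a , b , c ⟩

    ∑²-scale₁ : ∀ {l} → ¬ p∣ l →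
      ∑ₚ (λ b → ∑ₚ λ c → G ⟨ l , b , c ⟩) ≡ ∑ₚ (λ b → ∑ₚ λ c → G ⟨ 1ℤ , b , c ⟩)
    ∑²-scale₁ {l} p∤l = begin
      ∑ₚ (λ b → ∑ₚ λ c → G ⟨ l , b , c ⟩)
        ≡⟨ ∑ₚ-cong (λ b → ∑ₚ-dilate p∤l (λ c → G ⟨ l , b , c ⟩) λ c≈c′ → G-cong ≈-refl ≈-refl c≈c′) ⟨
      ∑ₚ (λ b → ∑ₚ λ c → G ⟨ l , b , l * c ⟩)
        ≡⟨ ∑ₚ-dilate p∤l (λ b → ∑ₚ λ c → G ⟨ l , b , l * c ⟩)
             (λ b≈b′ → ∑ₚ-cong λ c → G-cong (≈-refl {l}) b≈b′ (≈-refl {l * c})) ⟨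
      ∑ₚ (λ b → ∑ₚ λ c → G ⟨ l , l * b , l * c ⟩)
        ≡⟨ ∑ₚ-cong (λ b → ∑ₚ-cong λ c →
             trans (cong (λ l′ → G ⟨ l′ , l * b , l * c ⟩) (sym (ℤP.*-identityʳ l))) (scale p∤l 1ℤ b c)) ⟩
      ∑ₚ (λ b → ∑ₚ λ c → G ⟨ 1ℤ , b , c ⟩) ∎
      where open ≡-Reasoning

    ∑-scale₂ : ∀ {l} → ¬ p∣ l → ∑ₚ (λ c → G ⟨ 0ℤ , l , c ⟩) ≡ ∑ₚ (λ c → G ⟨ 0ℤ , 1ℤ , c ⟩)
    ∑-scale₂ {l} p∤l = begin
      ∑ₚ (λ c → G ⟨ 0ℤ , l , c ⟩)
        ≡⟨ ∑ₚ-dilate p∤l (λ c → G ⟨ 0ℤ , l , c ⟩) (λ c≈c′ → G-cong ≈-refl ≈-refl c≈c′) ⟨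
      ∑ₚ (λ c → G ⟨ 0ℤ , l , l * c ⟩)
        ≡⟨ ∑ₚ-cong (λ c → trans (cong₂ (λ z l′ → G ⟨ z , l′ , l * c ⟩) (sym (ℤP.*-zeroʳ l)) (sym (ℤP.*-identityʳ l)))
                                  (scale p∤l 0ℤ 1ℤ c)) ⟩
      ∑ₚ (λ c → G ⟨ 0ℤ , 1ℤ , c ⟩) ∎
      where open ≡-Reasoning

    scale₃ : ∀ {l} → ¬ p∣ l → G ⟨ 0ℤ , 0ℤ , l ⟩ ≡ G ⟨ 0ℤ , 0ℤ , 1ℤ ⟩
    scale₃ {l} p∤l = trans (cong₂ (λ z l′ → G ⟨ z , z , l′ ⟩) (sym (ℤP.*-zeroʳ l)) (sym (ℤP.*-identityʳ l)))
                           (scale p∤l 0ℤ 0ℤ 1ℤ)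

    ∑³-projective : G 0³ ≡ 0ℤ → ∑³ G ≡ P₋₁ * ∑ℙ² G
    ∑³-projective G0≡0 = begin
      ∑³ G
        ≡⟨ ∑ₚ-units (λ a → ∑ₚ λ b → ∑ₚ λ c → G ⟨ a , b , c ⟩) A (λ _ → ∑²-scale₁) ⟩
      ∑ₚ (λ b → ∑ₚ λ c → G ⟨ 0ℤ , b , c ⟩) + P₋₁ * A
        ≡⟨ cong (_+ P₋₁ * A) (∑ₚ-units (λ b → ∑ₚ λ c → G ⟨ 0ℤ , b , c ⟩) B (λ _ → ∑-scale₂)) ⟩
      ∑ₚ (λ c → G ⟨ 0ℤ , 0ℤ , c ⟩) + P₋₁ * B + P₋₁ * A
        ≡⟨ cong (λ x → x + P₋₁ * B + P₋₁ * A) (∑ₚ-units (λ c → G ⟨ 0ℤ , 0ℤ , c ⟩) C (λ _ → scale₃)) ⟩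
      G 0³ + P₋₁ * C + P₋₁ * B + P₋₁ * A
        ≡⟨ cong (λ x → x + P₋₁ * C + P₋₁ * B + P₋₁ * A) G0≡0 ⟩
      0ℤ + P₋₁ * C + P₋₁ * B + P₋₁ * A
        ≡⟨ collect P₋₁ A B C ⟩
      P₋₁ * ∑ℙ² G ∎
      where
      open ≡-Reasoning
      A = ∑ₚ (λ a → ∑ₚ λ b → G ⟨ 1ℤ , a , b ⟩)
      B = ∑ₚ (λ c → G ⟨ 0ℤ , 1ℤ , c ⟩)
      C = G ⟨ 0ℤ , 0ℤ , 1ℤ ⟩
      collect : ∀ q A B C → 0ℤ + q * C + q * B + q * A ≡ q * (A + (C + B))
      collect = solve-∀

  -- Normalised representatives ⟨1,a,b⟩, ⟨0,0,1⟩, ⟨0,1,c⟩ of the points of the projective plane over 𝔽ₚ.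
  O : ℕ
  O = p ℕ.* p ℕ.+ suc p

  point : Fin O → ℤ³
  point i with splitAt (p ℕ.* p) i
  ... | inj₁ ab      = ⟨ 1ℤ , toℤ (proj₁ (remQuot {p} p ab)) , toℤ (proj₂ (remQuot {p} p ab)) ⟩
  ... | inj₂ zero    = ⟨ 0ℤ , 0ℤ , 1ℤ ⟩
  ... | inj₂ (suc c) = ⟨ 0ℤ , 1ℤ , toℤ c ⟩

  affineIndex : Fin p → Fin p → Fin O
  affineIndex a b = combine {p} {p} a b ↑ˡ suc p

  point-affine : ∀ a b → point (affineIndex a b) ≡ ⟨ 1ℤ , toℤ a , toℤ b ⟩
  point-affine a b rewrite FP.splitAt-↑ˡ (p ℕ.* p) (combine {p} {p} a b) (suc p) =
    cong (λ ab → ⟨ 1ℤ , toℤ (proj₁ ab) , toℤ (proj₂ ab) ⟩) (FP.remQuot-combine {p} {p} a b)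

  point-vertical : point ((p ℕ.* p) ↑ʳ zero) ≡ ⟨ 0ℤ , 0ℤ , 1ℤ ⟩
  point-vertical rewrite FP.splitAt-↑ʳ (p ℕ.* p) (suc p) zero = refl

  point-infinite : ∀ c → point ((p ℕ.* p) ↑ʳ suc c) ≡ ⟨ 0ℤ , 1ℤ , toℤ c ⟩
  point-infinite c rewrite FP.splitAt-↑ʳ (p ℕ.* p) (suc p) (suc c) = refl

  data PointView : Fin O → Set where
    affine   : ∀ a b → PointView (affineIndex a b)
    vertical : PointView ((p ℕ.* p) ↑ʳ zero)
    infinite : ∀ c → PointView ((p ℕ.* p) ↑ʳ suc c)

  pointView : ∀ i → PointView i
  pointView = +-elim (p ℕ.* p) (suc p) PointView
    (*-elim p p (λ ab → PointView (ab ↑ˡ suc p)) affine)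
    λ { zero → vertical ; (suc c) → infinite c }

  ∑-point : ∀ f → ∑ O (f ∘ point) ≡ ∑ℙ² f
  ∑-point f = trans (∑-splitAt (p ℕ.* p) (suc p) (f ∘ point)) (cong₂ _+_
    (trans (∑-combine p p (λ ab → f (point (ab ↑ˡ suc p)))) (∑-cong p λ a → ∑-cong p λ b → cong f (point-affine a b)))
    (cong₂ _+_ (cong f point-vertical) (∑-cong p λ c → cong f (point-infinite c))))

  private
    p∤-distinct : ∀ {s t} → ¬ s ≡ t → ¬ p∣ (toℤ t - toℤ s)
    p∤-distinct s≢t p∣t-s = s≢t (sym (toℤ-injective (mod p∣t-s)))

    p∤-±1 : ∀ {x} → x ≡ 1ℤ ⊎ x ≡ -1ℤ → ¬ p∣ x
    p∤-±1 (inj₁ refl) = p∤1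
    p∤-±1 (inj₂ refl) = p∤1 ∘ p∣-neg

  Separator : Fin O → Fin O → Set
  Separator i j = Σ ℤ³ (λ d → point j · d ≡ 0ℤ × ¬ p∣ (point i · d))

  separator : ∀ i j → ¬ i ≡ j → Separator i j
  separator i j i≢j = go (pointView i) (pointView j) i≢j
    where
    go : ∀ {i j} → PointView i → PointView j → ¬ i ≡ j → Separator i j
    go (affine a b) (affine a′ b′) i≢j with a F.≟ a′
    ... | no a≢a′ rewrite point-affine a b | point-affine a′ b′ =
      ⟨ toℤ a′ , -1ℤ , 0ℤ ⟩ , e₁ (toℤ a′) (toℤ b′) , p∤-distinct a≢a′ ∘ subst p∣_ (e₂ (toℤ a) (toℤ b) (toℤ a′))
      where
      e₁ : ∀ a b → 1ℤ * a + a * -1ℤ + b * 0ℤ ≡ 0ℤ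
      e₁ = solve-∀
      e₂ : ∀ a b a′ → 1ℤ * a′ + a * -1ℤ + b * 0ℤ ≡ a′ - a
      e₂ = solve-∀
    ... | yes refl with b F.≟ b′
    ...   | yes refl = ⊥-elim (i≢j refl)
    ...   | no b≢b′ rewrite point-affine a b | point-affine a b′ =
      ⟨ - toℤ b′ , 0ℤ , 1ℤ ⟩ , e₁ (toℤ a) (toℤ b′) , p∤-distinct (b≢b′ ∘ sym) ∘ subst p∣_ (e₂ (toℤ a) (toℤ b) (toℤ b′))
      where
      e₁ : ∀ a b → 1ℤ * - b + a * 0ℤ + b * 1ℤ ≡ 0ℤ
      e₁ = solve-∀
      e₂ : ∀ a b b′ → 1ℤ * - b′ + a * 0ℤ + b * 1ℤ ≡ b - b′
      e₂ = solve-∀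
    go (affine a b) vertical _ rewrite point-affine a b | point-vertical =
      ⟨ 1ℤ , 0ℤ , 0ℤ ⟩ , refl , p∤-±1 (inj₁ (e (toℤ a) (toℤ b)))
      where
      e : ∀ a b → 1ℤ * 1ℤ + a * 0ℤ + b * 0ℤ ≡ 1ℤ
      e = solve-∀
    go (affine a b) (infinite c) _ rewrite point-affine a b | point-infinite c =
      ⟨ 1ℤ , 0ℤ , 0ℤ ⟩ , e₁ (toℤ c) , p∤-±1 (inj₁ (e₂ (toℤ a) (toℤ b)))
      where
      e₁ : ∀ c → 0ℤ * 1ℤ + 1ℤ * 0ℤ + c * 0ℤ ≡ 0ℤ
      e₁ = solve-∀
      e₂ : ∀ a b → 1ℤ * 1ℤ + a * 0ℤ + b * 0ℤ ≡ 1ℤ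
      e₂ = solve-∀
    go vertical (affine a b) _ rewrite point-vertical | point-affine a b =
      ⟨ - toℤ b , 0ℤ , 1ℤ ⟩ , e (toℤ a) (toℤ b) , p∤-±1 (inj₁ refl)
      where
      e : ∀ a b → 1ℤ * - b + a * 0ℤ + b * 1ℤ ≡ 0ℤ
      e = solve-∀
    go vertical vertical i≢j = ⊥-elim (i≢j refl)
    go vertical (infinite c) _ rewrite point-vertical | point-infinite c =
      ⟨ 0ℤ , toℤ c , -1ℤ ⟩ , e (toℤ c) , p∤-±1 (inj₂ refl)
      where
      e : ∀ c → 0ℤ * 0ℤ + 1ℤ * c + c * -1ℤ ≡ 0ℤ
      e = solve-∀
    go (infinite c) (affine a b) _ rewrite point-infinite c | point-affine a b =
      ⟨ toℤ a , -1ℤ , 0ℤ ⟩ , e₁ (toℤ a) (toℤ b) , p∤-±1 (inj₂ (e₂ (toℤ a) (toℤ c)))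
      where
      e₁ : ∀ a b → 1ℤ * a + a * -1ℤ + b * 0ℤ ≡ 0ℤ
      e₁ = solve-∀
      e₂ : ∀ a c → 0ℤ * a + 1ℤ * -1ℤ + c * 0ℤ ≡ -1ℤ
      e₂ = solve-∀
    go (infinite c) vertical _ rewrite point-infinite c | point-vertical =
      ⟨ 0ℤ , 1ℤ , 0ℤ ⟩ , refl , p∤-±1 (inj₁ (e (toℤ c)))
      where
      e : ∀ c → 0ℤ * 0ℤ + 1ℤ * 1ℤ + c * 0ℤ ≡ 1ℤ
      e = solve-∀
    go (infinite c) (infinite c′) i≢j with c F.≟ c′
    ... | yes refl = ⊥-elim (i≢j refl)
    ... | no c≢c′ rewrite point-infinite c | point-infinite c′ =
      ⟨ 0ℤ , toℤ c′ , -1ℤ ⟩ , e₁ (toℤ c′) , p∤-distinct c≢c′ ∘ subst p∣_ (e₂ (toℤ c) (toℤ c′))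
      where
      e₁ : ∀ c → 0ℤ * 0ℤ + 1ℤ * c + c * -1ℤ ≡ 0ℤ
      e₁ = solve-∀
      e₂ : ∀ c c′ → 0ℤ * 0ℤ + 1ℤ * c′ + c * -1ℤ ≡ c′ - c
      e₂ = solve-∀

  normalise : ∀ x y d → y · d ≡ 0ℤ → ¬ p∣ (x · d) → Σ ℤ³ (λ d′ → x · d′ ≈ 1ℤ × y · d′ ≈ 0ℤ)
  normalise x y d y·d≡0 p∤x·d with inverse p∤x·d
  ... | m , x·d*m≈1 =
    m • d , ≈-trans (≈-reflexive (trans (·-•ʳ x m d) (ℤP.*-comm m (x · d)))) x·d*m≈1
          , ≈-reflexive (trans (·-•ʳ y m d) (trans (cong (m *_) y·d≡0) (ℤP.*-zeroʳ m)))

  dual : ∀ i → Σ ℤ³ (λ d → point i · d ≈ 1ℤ)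
  dual i = go (pointView i)
    where
    go : ∀ {i} → PointView i → Σ ℤ³ (λ d → point i · d ≈ 1ℤ)
    go (affine a b) rewrite point-affine a b = ⟨ 1ℤ , 0ℤ , 0ℤ ⟩ , ≈-reflexive (e (toℤ a) (toℤ b))
      where
      e : ∀ a b → 1ℤ * 1ℤ + a * 0ℤ + b * 0ℤ ≡ 1ℤ
      e = solve-∀
    go vertical rewrite point-vertical = ⟨ 0ℤ , 0ℤ , 1ℤ ⟩ , ≈-refl
    go (infinite c) rewrite point-infinite c = ⟨ 0ℤ , 1ℤ , 0ℤ ⟩ , ≈-reflexive (e (toℤ c))
      where
      e : ∀ c → 0ℤ * 0ℤ + 1ℤ * 1ℤ + c * 0ℤ ≡ 1ℤ
      e = solve-∀

  plane : Matrix O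
  plane i j = χ (point i · point j)

  χχ-homogeneous : ∀ x y → Homogeneous (λ z → χ (x · z) * χ (y · z))
  χχ-homogeneous x y {l} p∤l z = begin
    χ (x · l • z) * χ (y · l • z)              ≡⟨ cong₂ (λ s t → χ s * χ t) (·-•ʳ x l z) (·-•ʳ y l z) ⟩
    χ (l * (x · z)) * χ (l * (y · z))          ≡⟨ cong₂ _*_ (χ-* l (x · z)) (χ-* l (y · z)) ⟩
    (χ l * χ (x · z)) * (χ l * χ (y · z))      ≡⟨ interchange (χ l) (χ (x · z)) (χ (y · z)) ⟩
    (χ l * χ l) * (χ (x · z) * χ (y · z))      ≡⟨ cong (_* (χ (x · z) * χ (y · z))) (χ²-unit p∤l) ⟩
    1ℤ * (χ (x · z) * χ (y · z))               ≡⟨ ℤP.*-identityˡ (χ (x · z) * χ (y · z)) ⟩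
    χ (x · z) * χ (y · z)                      ∎
    where
    open ≡-Reasoning
    interchange : ∀ e s t → (e * s) * (e * t) ≡ (e * e) * (s * t)
    interchange = solve-∀

  mulTranspose-plane : ∀ i j → P₋₁ * mulTranspose O plane i j ≡ ∑³ (λ z → χ (point i · z) * χ (point j · z))
  mulTranspose-plane i j = trans (cong (P₋₁ *_) (∑-point G))
    (sym (∑³-projective G G-cong (χχ-homogeneous x y) (cong (_* χ (y · 0³)) (χ-p∣ (subst p∣_ (sym (·-zeroʳ x)) p∣0)))))
    where
    x = point i
    y = point j
    G : ℤ³ → ℤ
    G z = χ (x · z) * χ (y · z)
    G-cong : Congruent³ G
    G-cong a≈a′ b≈b′ c≈c′ = cong₂ _*_ (χ-cong (·-congʳ x a≈a′ b≈b′ c≈c′)) (χ-cong (·-congʳ y a≈a′ b≈b′ c≈c′))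

  private
    cancel : ∀ {m n} → P * (P₋₁ * m) ≡ P * (P₋₁ * n) → m ≡ n
    cancel {m} {n} eq = ℤP.*-cancelˡ-≡ P₋₁ m n (ℤP.*-cancelˡ-≡ P (P₋₁ * m) (P₋₁ * n) eq)

  mulTranspose-plane-≢ : ∀ i j → ¬ i ≡ j → mulTranspose O plane i j ≡ 0ℤ
  mulTranspose-plane-≢ i j i≢j = cancel (begin
    P * (P₋₁ * mulTranspose O plane i j)                    ≡⟨ cong (P *_) (mulTranspose-plane i j) ⟩
    P * ∑³ (λ z → χ (point i · z) * χ (point j · z))        ≡⟨ ∑³-average χ χ χ-cong χ-cong (point i) (point j) d′ x·d′≈1 y·d′≈0 ⟩
    ∑³ (λ z → χ (point j · z)) * ∑ₚ χ                       ≡⟨ cong (∑³ (λ z → χ (point j · z)) *_) ∑ₚ-χ ⟩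
    ∑³ (λ z → χ (point j · z)) * 0ℤ                         ≡⟨ ℤP.*-zeroʳ (∑³ (λ z → χ (point j · z))) ⟩
    0ℤ                                                      ≡⟨ ℤP.*-zeroʳ P ⟨
    P * 0ℤ                                                  ≡⟨ cong (P *_) (ℤP.*-zeroʳ P₋₁) ⟨
    P * (P₋₁ * 0ℤ)                                          ∎)
    where
    open ≡-Reasoning
    separating : Σ ℤ³ (λ d′ → point i · d′ ≈ 1ℤ × point j · d′ ≈ 0ℤ)
    separating = let (d , y·d≡0 , p∤x·d) = separator i j i≢j in normalise (point i) (point j) d y·d≡0 p∤x·d
    d′ = proj₁ separating
    x·d′≈1 = proj₁ (proj₂ separating)
    y·d′≈0 = proj₂ (proj₂ separating)

  mulTranspose-plane-≡ : ∀ i → mulTranspose O plane i i ≡ P * P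
  mulTranspose-plane-≡ i = cancel (begin
    P * (P₋₁ * mulTranspose O plane i i)                    ≡⟨ cong (P *_) (mulTranspose-plane i i) ⟩
    P * ∑³ (λ z → χ (x · z) * χ (x · z))                    ≡⟨ cong (P *_) (∑³-cong λ z → sym (ℤP.*-identityʳ (χ (x · z) * χ (x · z)))) ⟩
    P * ∑³ (λ z → (χ (x · z) * χ (x · z)) * 1ℤ)             ≡⟨ ∑³-average χ² (λ _ → 1ℤ) χ²-cong (λ _ → refl) x 0³ d x·d≈1 0³·d≈0 ⟩
    ∑³ (λ _ → 1ℤ) * ∑ₚ χ²                                   ≡⟨ cong₂ _*_ (∑³-const 1ℤ) ∑ₚ-χ² ⟩
    P * (P * (P * 1ℤ)) * P₋₁                                ≡⟨ rearrange P P₋₁ ⟩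
    P * (P₋₁ * (P * P))                                     ∎)
    where
    open ≡-Reasoning
    x = point i
    d = proj₁ (dual i)
    x·d≈1 = proj₂ (dual i)
    χ² : ℤ → ℤ
    χ² t = χ t * χ t
    χ²-cong : χ² Preserves _≈_ ⟶ _≡_
    χ²-cong a≈b = cong₂ _*_ (χ-cong a≈b) (χ-cong a≈b)
    0³·d≈0 : 0³ · d ≈ 0ℤ
    0³·d≈0 = ≈-reflexive (trans (·-comm 0³ d) (·-zeroʳ d))
    ∑ₚ-χ² : ∑ₚ χ² ≡ P₋₁
    ∑ₚ-χ² = trans (∑ₚ-units χ² 1ℤ (λ _ → χ²-unit)) (trans (cong (λ c → c * c + P₋₁ * 1ℤ) (χ-p∣ p∣0))
                  (trans (ℤP.+-identityˡ (P₋₁ * 1ℤ)) (ℤP.*-identityʳ P₋₁)))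
    rearrange : ∀ P Q → P * (P * (P * 1ℤ)) * Q ≡ P * (Q * (P * P))
    rearrange = solve-∀

  symmetricWeighing-plane : SymmetricWeighingMatrix O (p ℕ.* p)
  symmetricWeighing-plane = plane , ((λ i j → χ-ternary (point i · point j)) , orthogonal) , symmetric
    where
    symmetric : IsSymmetric O plane
    symmetric i j = cong χ (·-comm (point i) (point j))
    orthogonal : ∀ i j → mulTranspose O plane i j ≡ scaledId O (p ℕ.* p) i j
    orthogonal i j = scaledId-elim (mulTranspose O plane i j ≡_) (p ℕ.* p) i j
      (λ { refl → trans (mulTranspose-plane-≡ i) (sym (ℤP.pos-* p p)) })
      (mulTranspose-plane-≢ i j)

open import Data.Nat using (_+_; _*_; _∸_)
open import Data.Nat.DivMod using (_/_; _%_; m≡m%n+[m/n]*n; m%n<n; m*n/n≡m; /-monoˡ-≤)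
open import Data.Nat.Primality.Factorisation using (factorise)
open import Data.Nat.ListAction using (product)
open import Data.Nat.Tactic.RingSolver using (solve-∀)
open import Data.List using ([]; _∷_)
open import Data.List.Relation.Unary.All using (All; []; _∷_)

symmetricWeighing-prime : ∀ {p} → Prime p → SymmetricWeighingMatrix (p * p + suc p) (p * p)
symmetricWeighing-prime {0}               p-prime = ⊥-elim (¬prime[0] p-prime)
symmetricWeighing-prime {1}               p-prime = ⊥-elim (¬prime[1] p-prime)
symmetricWeighing-prime {2}               _       = symmetricWeighing-7-4
symmetricWeighing-prime {suc (suc (suc r))} p-prime = OddPrime.symmetricWeighing-plane r p-prime

Odd : ℕ → Set
Odd n = ∃[ t ] n ≡ suc (2 * t)

odd-* : ∀ {a b} → Odd a → Odd b → Odd (a * b)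
odd-* (s , refl) (t , refl) = s + t + 2 * s * t , identity s t
  where
  identity : ∀ s t → suc (2 * s) * suc (2 * t) ≡ suc (2 * (s + t + 2 * s * t))
  identity = solve-∀

odd-p²+p+1 : ∀ p → Odd (p * p + suc p)
odd-p²+p+1 zero    = 0 , refl
odd-p²+p+1 (suc p) with odd-p²+p+1 p
... | t , eq = t + suc p , (begin
  suc p * suc p + suc (suc p)      ≡⟨ identity₁ p ⟩
  (p * p + suc p) + 2 * suc p      ≡⟨ cong (_+ 2 * suc p) eq ⟩
  suc (2 * t) + 2 * suc p          ≡⟨ identity₂ t p ⟩
  suc (2 * (t + suc p))            ∎)
  where
  open ≡-Reasoning
  identity₁ : ∀ p → suc p * suc p + suc (suc p) ≡ (p * p + suc p) + 2 * suc p
  identity₁ = solve-∀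
  identity₂ : ∀ t p → suc (2 * t) + 2 * suc p ≡ suc (2 * (t + suc p))
  identity₂ = solve-∀

oddOrder-product : ∀ ps → All Prime ps → Σ ℕ (λ O → Odd O × SymmetricWeighingMatrix O (product ps * product ps))
oddOrder-product []       []                 = 1 , (0 , refl) , symmetricWeighing-1
oddOrder-product (p ∷ ps) (p-prime ∷ ps-prime) with oddOrder-product ps ps-prime
... | O , O-odd , W =
  (p * p + suc p) * O , odd-* (odd-p²+p+1 p) O-odd ,
  subst (SymmetricWeighingMatrix _) (interchange p (product ps)) (symmetricWeighing-prime p-prime ⊗ W)
  where
  interchange : ∀ p q → p * p * (q * q) ≡ p * q * (p * q)
  interchange = solve-∀

oddOrder-square : ∀ m → .{{NonZero m}} → Σ ℕ (λ O → Odd O × SymmetricWeighingMatrix O (m * m))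
oddOrder-square m with factorise m
... | record { factors = ps ; isFactorisation = m≡∏ps ; factorsPrime = ps-prime } =
  subst (λ k → Σ ℕ (λ O → Odd O × SymmetricWeighingMatrix O k)) (cong (λ x → x * x) (sym m≡∏ps))
    (oddOrder-product ps ps-prime)

-- Squaring c O = 1 + s 2^(j+1) gives (c² O) O = 1 + s′ 2^(j+2).
odd-invertible-mod-2^ : ∀ {O} → Odd O → ∀ j → ∃[ c ] ∃[ s ] c * O ≡ suc (s * 2 ^ suc j)
odd-invertible-mod-2^ (t , refl) zero = 1 , t , identity t
  where
  identity : ∀ t → 1 * suc (2 * t) ≡ suc (t * (2 * 1))
  identity = solve-∀
odd-invertible-mod-2^ {O} O-odd (suc j) with odd-invertible-mod-2^ O-odd j
... | c , s , cO≡1+s2ʲ⁺¹ = c * c * O , s + s * s * 2 ^ j , (begin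
  c * c * O * O                              ≡⟨ identity₁ c O ⟩
  (c * O) * (c * O)                          ≡⟨ cong₂ _*_ cO≡1+s2ʲ⁺¹ cO≡1+s2ʲ⁺¹ ⟩
  suc (s * 2 ^ suc j) * suc (s * 2 ^ suc j)  ≡⟨ identity₂ s (2 ^ j) ⟩
  suc ((s + s * s * 2 ^ j) * 2 ^ suc (suc j)) ∎)
  where
  open ≡-Reasoning
  identity₁ : ∀ c O → c * c * O * O ≡ (c * O) * (c * O)
  identity₁ = solve-∀
  identity₂ : ∀ s X → suc (s * (2 * X)) * suc (s * (2 * X)) ≡ suc ((s + s * s * X) * (2 * (2 * X)))
  identity₂ = solve-∀

-- n = q a + r with r < a ≤ q, so n = (q − r) a + r (a + 1).
consecutive-combination : ∀ a n → a * a ≤ n → ∃[ x ] ∃[ y ] n ≡ x * a + y * suc a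
consecutive-combination zero       n _    = 0 , n , sym (ℕP.*-identityʳ n)
consecutive-combination a@(suc _) n a²≤n = n / a ∸ n % a , n % a , (begin
  n                                        ≡⟨ m≡m%n+[m/n]*n n a ⟩
  n % a + n / a * a                        ≡⟨ cong (λ z → n % a + z * a) (ℕP.m∸n+n≡m r≤q) ⟨
  n % a + (n / a ∸ n % a + n % a) * a      ≡⟨ identity (n % a) (n / a ∸ n % a) a ⟩
  (n / a ∸ n % a) * a + n % a * suc a      ∎)
  where
  open ≡-Reasoning
  identity : ∀ r x a → r + (x + r) * a ≡ x * a + r * suc a
  identity = solve-∀
  r≤q : n % a ≤ n / a
  r≤q = ℕP.≤-trans (ℕP.<⇒≤ (m%n<n n a)) (subst (_≤ n / a) (m*n/n≡m a a) (/-monoˡ-≤ a a²≤n))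

consecutive-orders : ∀ {j O} → Odd O → SymmetricWeighingMatrix O (suc j) →
  Σ ℕ (λ a → SymmetricWeighingMatrix a (suc j) × SymmetricWeighingMatrix (suc a) (suc j))
consecutive-orders {j} O-odd W with odd-invertible-mod-2^ O-odd j
... | c , s , cO≡1+s2ʲ⁺¹ = s * 2 ^ suc j ,
  subst (λ n → SymmetricWeighingMatrix n (suc j)) (ℕP.*-assoc s 2 (2 ^ j)) (replicate (s * 2) (symmetricWeighing-2^ j)) ,
  subst (λ n → SymmetricWeighingMatrix n (suc j)) cO≡1+s2ʲ⁺¹ (replicate c W)

all-orders-from : ∀ {a k} → SymmetricWeighingMatrix a k → SymmetricWeighingMatrix (suc a) k →
  ∀ n → a * a ≤ n → SymmetricWeighingMatrix n k
all-orders-from {a} {k} A A′ n a²≤n with consecutive-combination a n a²≤n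
... | x , y , n≡xa+y[a+1] = subst (λ m → SymmetricWeighingMatrix m k) (sym n≡xa+y[a+1]) (replicate x A ⊕ replicate y A′)

nonZero-root : ∀ {j} m → suc j ≡ m * m → NonZero m
nonZero-root (suc _) _ = _

theorem3p11 : (k : ℕ) → NonZero k → (∃[ m ] k ≡ m * m) →
    ∃[ N ] ((n : ℕ) → n ≥ N →
    Σ (Matrix n) (λ W → IsWeighingMatrix n k W × IsSymmetric n W))
theorem3p11 (suc j) _ (m , k≡m²) with oddOrder-square m {{nonZero-root m k≡m²}}
... | O , O-odd , W with consecutive-orders O-odd (subst (SymmetricWeighingMatrix O) (sym k≡m²) W)
...   | a , A , A′ = a * a , all-orders-from A A′
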